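{- Let $m,n\ge 1$ be integers with $\gcd(m,n)=1$, and let $g_3(m,n)$ be the number of $(a,b,c)\in\mathbb{Z}_n^3$ with $a+b+c\equiv m\pmod n$, $\gcd(abc,n)=1$ and $\gcd(ab+bc+ca,n)=1$. Then \[ g_3(m,n)=n^2\prod_{p\mid n}\left(1-\frac{3}{p}+\frac{6-h(p)}{p^2}\right), \] where for a prime $p$: $h(p)=3$ if $p=3$, $h(p)=p-1$ if $p\equiv 1\pmod 3$, and $h(p)=p+1$ if $p\equiv 2\pmod 3$. -}

module Defs where

open import Data.Nat as ℕ using (ℕ; zero; suc; _^_; _%_)
open import Data.Nat.GCD using (gcd)
open import Data.Nat.Primality using (Prime; prime?)
open import Data.Nat.Divisibility using (_∣?_)
open import Data.Integer as ℤ using (ℤ; +_)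
open import Data.Integer.Divisibility as ℤD using ()
open import Data.Rational as ℚ using (ℚ; _/_)
open import Data.List using (List; []; _∷_; filter; length; upTo; concatMap; map)
open import Data.Product using (_×_; _,_)
open import Relation.Nullary using (Dec; yes; no)
open import Relation.Nullary.Decidable using (_×-dec_)
open import Data.Nat using (_≟_)
import Data.Integer.Properties as ℤP

-- h(p) for a prime p: 3 if p = 3, p - 1 if p ≡ 1 (mod 3), p + 1 if p ≡ 2 (mod 3)
-- (returned as an integer; the case p ≡ 0 (mod 3), p ≠ 3 never occurs for primes)
h : ℕ → ℤ
h p with p % 3
... | 1 = + p ℤ.- + 1
... | 2 = + p ℤ.+ + 1
... | _ = + 3

factor : (p : ℕ) → .{{ℕ.NonZero p}} → ℚ
factor p = (+ 1 / 1) ℚ.- (+ 3 / p) ℚ.+ ((+ 6 ℤ.- h p) / (p ^ 2))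
  where instance
    nz2 : ℕ.NonZero (p ^ 2)
    nz2 = Data.Nat.Properties.m^n≢0 p 2
      where import Data.Nat.Properties

prodUpTo : ℕ → ℕ → ℚ
prodUpTo n zero = + 1 / 1
prodUpTo n (suc k) with prime? (suc k) | suc k ∣? n
... | yes _ | yes _ = prodUpTo n k ℚ.* factor (suc k)
... | _     | _     = prodUpTo n k

primeProd : ℕ → ℚ
primeProd n = prodUpTo n n

triples : ℕ → List (ℕ × ℕ × ℕ)
triples n = concatMap (λ a → concatMap (λ b → map (λ c → (a , b , c)) (upTo n)) (upTo n)) (upTo n)

Good : ℕ → ℕ → ℕ × ℕ × ℕ → Set
Good m n (a , b , c) =
  ((+ n) ℤD.∣ (+ (a ℕ.+ b ℕ.+ c) ℤ.- + m))
  × gcd (a ℕ.* b ℕ.* c) n ≡ 1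
  × gcd (a ℕ.* b ℕ.+ b ℕ.* c ℕ.+ c ℕ.* a) n ≡ 1
  where open import Relation.Binary.PropositionalEquality using (_≡_)

good? : (m n : ℕ) → (t : ℕ × ℕ × ℕ) → Dec (Good m n t)
good? m n (a , b , c) =
  (n ∣? ℤ.∣ + (a ℕ.+ b ℕ.+ c) ℤ.- + m ∣)
  ×-dec (gcd (a ℕ.* b ℕ.* c) n ≟ 1)
  ×-dec (gcd (a ℕ.* b ℕ.+ b ℕ.* c ℕ.+ c ℕ.* a) n ≟ 1)

g₃ : ℕ → ℕ → ℕ
g₃ m n = length (filter (good? m n) (triples n))

module Submission where

-- Eliminating c = m − a − b, g₃(m, n) counts the pairs (a, b) mod n at which
-- e₃ = abc and e₂ = ab + bc + ca are both coprime to n. That condition only sees (a, b)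
-- modulo the primes dividing n, so by the Chinese remainder theorem the count G(n) is
-- multiplicative, and multiplying n by a prime p that already divides it multiplies G by p².
-- For a prime p ∤ m, inclusion–exclusion gives
--   G(p) = p² − #{e₃ ≡ 0} − #{e₂ ≡ 0} + #{e₃ ≡ e₂ ≡ 0} = p² − (3p − 3) − #{e₂ ≡ 0} + 3,
-- and slicing the conic e₂ ≡ 0 by slopes b = t a gives #{e₂ ≡ 0} = p + 1 − r, where r is the
-- number of roots of t² + t + 1 mod p. For p ≠ 3 the rotation (a, b, c) ↦ (b, c, a) acts on
-- that conic without fixed points, so 3 ∣ p + 1 − r; as r ≤ 2, this forces p + 1 − r = h(p).

open import Data.Nat using (ℕ; suc)
open import Data.Nat.Divisibility using (_∣_)
open import Data.Nat.Primality using (Prime)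
open import Relation.Nullary using (Dec; yes; no; ¬_)
import Defs

module Sums where
  open import Data.Empty using (⊥; ⊥-elim)
  open import Data.Nat
  open import Data.Nat.Properties
  open import Algebra.Properties.CommutativeSemigroup +-commutativeSemigroup using (interchange)
  open import Data.Product using (Σ-syntax; _×_; _,_)
  open import Data.Sum using (_⊎_; inj₁; inj₂)
  open import Function using (_∘_; _⇔_; mk⇔; Equivalence)
  open import Relation.Binary.PropositionalEquality
  open import Relation.Nullary using (Dec; yes; no; ¬_)
  open import Relation.Nullary.Decidable using (_×-dec_; _⊎-dec_; ¬?)
  open ≡-Reasoning

  ∑< : ℕ → (ℕ → ℕ) → ℕ
  ∑< zero    f = 0
  ∑< (suc n) f = f 0 + ∑< n (f ∘ suc)

  infixl 10 ∑<
  syntax ∑< n (λ x → e) = ∑[ x < n ] e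

  ∑-cong : ∀ n {f g : ℕ → ℕ} → (∀ x → x < n → f x ≡ g x) → ∑< n f ≡ ∑< n g
  ∑-cong zero    f≡g = refl
  ∑-cong (suc n) f≡g = cong₂ _+_ (f≡g 0 z<s) (∑-cong n (λ x x<n → f≡g (suc x) (s<s x<n)))

  ∑-cong-≗ : ∀ n {f g : ℕ → ℕ} → f ≗ g → ∑< n f ≡ ∑< n g
  ∑-cong-≗ n f≗g = ∑-cong n (λ x _ → f≗g x)

  ∑-mono-≤ : ∀ n {f g : ℕ → ℕ} → (∀ x → x < n → f x ≤ g x) → ∑< n f ≤ ∑< n g
  ∑-mono-≤ zero    f≤g = z≤n
  ∑-mono-≤ (suc n) f≤g = +-mono-≤ (f≤g 0 z<s) (∑-mono-≤ n (λ x x<n → f≤g (suc x) (s<s x<n)))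

  ∑-distrib-+ : ∀ n (f g : ℕ → ℕ) → ∑[ x < n ] (f x + g x) ≡ ∑< n f + ∑< n g
  ∑-distrib-+ zero    f g = refl
  ∑-distrib-+ (suc n) f g = trans (cong (f 0 + g 0 +_) (∑-distrib-+ n (f ∘ suc) (g ∘ suc)))
                                  (interchange (f 0) (g 0) _ _)

  *-distribˡ-∑ : ∀ n k (f : ℕ → ℕ) → k * ∑< n f ≡ ∑[ x < n ] (k * f x)
  *-distribˡ-∑ zero    k f = *-zeroʳ k
  *-distribˡ-∑ (suc n) k f = trans (*-distribˡ-+ k (f 0) _) (cong (k * f 0 +_) (*-distribˡ-∑ n k (f ∘ suc)))

  *-distribʳ-∑ : ∀ n k (f : ℕ → ℕ) → ∑< n f * k ≡ ∑[ x < n ] (f x * k)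
  *-distribʳ-∑ n k f = trans (*-comm _ k) (trans (*-distribˡ-∑ n k f) (∑-cong-≗ n (λ x → *-comm k (f x))))

  ∑-const : ∀ n k → ∑[ _ < n ] k ≡ n * k
  ∑-const zero    k = refl
  ∑-const (suc n) k = cong (k +_) (∑-const n k)

  ∑-count : ∀ n → ∑[ _ < n ] 1 ≡ n
  ∑-count n = trans (∑-const n 1) (*-identityʳ n)

  ∑-zero : ∀ n {f : ℕ → ℕ} → (∀ x → x < n → f x ≡ 0) → ∑< n f ≡ 0
  ∑-zero n f≡0 = trans (∑-cong n f≡0) (trans (∑-const n 0) (*-zeroʳ n))

  ∑-split : ∀ a b (f : ℕ → ℕ) → ∑< (a + b) f ≡ ∑< a f + ∑[ x < b ] f (a + x)
  ∑-split zero    b f = refl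
  ∑-split (suc a) b f = trans (cong (f 0 +_) (∑-split a b (f ∘ suc))) (sym (+-assoc (f 0) _ _))

  ∑-blocks : ∀ a b (f : ℕ → ℕ) → ∑< (a * b) f ≡ ∑[ k < a ] ∑[ i < b ] f (k * b + i)
  ∑-blocks zero    b f = refl
  ∑-blocks (suc a) b f = begin
    ∑< (b + a * b) f
      ≡⟨ ∑-split b (a * b) f ⟩
    ∑< b f + ∑[ x < a * b ] f (b + x)
      ≡⟨ cong (∑< b f +_) (∑-blocks a b (λ x → f (b + x))) ⟩
    ∑< b f + ∑[ k < a ] ∑[ i < b ] f (b + (k * b + i))
      ≡⟨ cong (∑< b f +_) (∑-cong-≗ a λ k →
         ∑-cong-≗ b λ i → cong f (sym (+-assoc b (k * b) i))) ⟩
    ∑< b f + ∑[ k < a ] ∑[ i < b ] f (suc k * b + i) ∎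

  ∑-comm : ∀ a b (f : ℕ → ℕ → ℕ) → ∑[ x < a ] ∑[ y < b ] f x y ≡ ∑[ y < b ] ∑[ x < a ] f x y
  ∑-comm zero    b f = sym (∑-zero b (λ _ _ → refl))
  ∑-comm (suc a) b f = trans (cong (∑< b (f 0) +_) (∑-comm a b (f ∘ suc)))
                             (sym (∑-distrib-+ b (f 0) (λ y → ∑[ x < a ] f (suc x) y)))

  ∑≢0⇒∃ : ∀ n (f : ℕ → ℕ) → ∑< n f ≢ 0 → Σ[ x ∈ ℕ ] x < n × f x ≢ 0
  ∑≢0⇒∃ zero    f ∑≢0 = ⊥-elim (∑≢0 refl)
  ∑≢0⇒∃ (suc n) f ∑≢0 with f 0 ≟ 0
  ... | no f0≢0  = 0 , z<s , f0≢0
  ... | yes f0≡0 with ∑≢0⇒∃ n (f ∘ suc) (λ ∑≡0 → ∑≢0 (cong₂ _+_ f0≡0 ∑≡0))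
  ...   | x , x<n , fx≢0 = suc x , s<s x<n , fx≢0

  𝟙 : ∀ {a} {A : Set a} → Dec A → ℕ
  𝟙 (yes _) = 1
  𝟙 (no _)  = 0

  module _ {a} {A : Set a} where

    𝟙-yes : A → (d : Dec A) → 𝟙 d ≡ 1
    𝟙-yes x (yes _) = refl
    𝟙-yes x (no ¬x) = ⊥-elim (¬x x)

    𝟙-no : ¬ A → (d : Dec A) → 𝟙 d ≡ 0
    𝟙-no ¬x (yes x) = ⊥-elim (¬x x)
    𝟙-no ¬x (no _)  = refl

    𝟙≢0⇒ : (d : Dec A) → 𝟙 d ≢ 0 → A
    𝟙≢0⇒ (yes x) _   = x
    𝟙≢0⇒ (no _)  1≢0 = ⊥-elim (1≢0 refl)

  module _ {a b} {A : Set a} {B : Set b} where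

    𝟙-cong : A ⇔ B → (d : Dec A) (e : Dec B) → 𝟙 d ≡ 𝟙 e
    𝟙-cong A⇔B (yes x) e = sym (𝟙-yes (Equivalence.to A⇔B x) e)
    𝟙-cong A⇔B (no ¬x) e = sym (𝟙-no (¬x ∘ Equivalence.from A⇔B) e)

    𝟙-× : (d : Dec A) (e : Dec B) → 𝟙 (d ×-dec e) ≡ 𝟙 d * 𝟙 e
    𝟙-× (yes _) (yes _) = refl
    𝟙-× (yes _) (no _)  = refl
    𝟙-× (no _)  _       = refl

    𝟙-⊎ : (A → B → ⊥) → (d : Dec A) (e : Dec B) → 𝟙 (d ⊎-dec e) ≡ 𝟙 d + 𝟙 e
    𝟙-⊎ disjoint (yes x) (yes y) = ⊥-elim (disjoint x y)
    𝟙-⊎ disjoint (yes _) (no _)  = refl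
    𝟙-⊎ disjoint (no _)  (yes _) = refl
    𝟙-⊎ disjoint (no _)  (no _)  = refl

    𝟙-inclusion-exclusion : (d : Dec A) (e : Dec B) → 𝟙 (¬? d ×-dec ¬? e) + 𝟙 d + 𝟙 e ≡ 1 + 𝟙 (d ×-dec e)
    𝟙-inclusion-exclusion (yes _) (yes _) = refl
    𝟙-inclusion-exclusion (yes _) (no _)  = refl
    𝟙-inclusion-exclusion (no _)  (yes _) = refl
    𝟙-inclusion-exclusion (no _)  (no _)  = refl

  module _ {a b c} {A : Set a} {B : Set b} {C : Set c} where

    𝟙-⊎₃ : (A → B → C → ⊥) → (A? : Dec A) (B? : Dec B) (C? : Dec C) →
           𝟙 (A? ⊎-dec B? ⊎-dec C?) + (𝟙 A? * 𝟙 B? + 𝟙 A? * 𝟙 C? + 𝟙 B? * 𝟙 C?) ≡ 𝟙 A? + 𝟙 B? + 𝟙 C?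
    𝟙-⊎₃ ¬ABC (yes x) (yes y) (yes z) = ⊥-elim (¬ABC x y z)
    𝟙-⊎₃ ¬ABC (yes _) (yes _) (no _)  = refl
    𝟙-⊎₃ ¬ABC (yes _) (no _)  (yes _) = refl
    𝟙-⊎₃ ¬ABC (yes _) (no _)  (no _)  = refl
    𝟙-⊎₃ ¬ABC (no _)  (yes _) (yes _) = refl
    𝟙-⊎₃ ¬ABC (no _)  (yes _) (no _)  = refl
    𝟙-⊎₃ ¬ABC (no _)  (no _)  (yes _) = refl
    𝟙-⊎₃ ¬ABC (no _)  (no _)  (no _)  = refl

    𝟙-two-of-three : (A → B → C → ⊥) → (A? : Dec A) (B? : Dec B) (C? : Dec C) →
                     𝟙 ((A? ×-dec B?) ⊎-dec (A? ×-dec C?) ⊎-dec (B? ×-dec C?))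
                       ≡ 𝟙 A? * 𝟙 B? + 𝟙 A? * 𝟙 C? + 𝟙 B? * 𝟙 C?
    𝟙-two-of-three ¬ABC (yes x) (yes y) (yes z) = ⊥-elim (¬ABC x y z)
    𝟙-two-of-three ¬ABC (yes _) (yes _) (no _)  = refl
    𝟙-two-of-three ¬ABC (yes _) (no _)  (yes _) = refl
    𝟙-two-of-three ¬ABC (yes _) (no _)  (no _)  = refl
    𝟙-two-of-three ¬ABC (no _)  (yes _) (yes _) = refl
    𝟙-two-of-three ¬ABC (no _)  (yes _) (no _)  = refl
    𝟙-two-of-three ¬ABC (no _)  (no _)  (yes _) = refl
    𝟙-two-of-three ¬ABC (no _)  (no _)  (no _)  = refl

    𝟙-mono-⊎ : (A → B ⊎ C) → (A? : Dec A) (B? : Dec B) (C? : Dec C) → 𝟙 A? ≤ 𝟙 B? + 𝟙 C?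
    𝟙-mono-⊎ A⇒B⊎C (no _)  B? C? = z≤n
    𝟙-mono-⊎ A⇒B⊎C (yes x) B? C? with A⇒B⊎C x
    ... | inj₁ y = ≤-trans (≤-reflexive (sym (𝟙-yes y B?))) (m≤m+n (𝟙 B?) (𝟙 C?))
    ... | inj₂ z = ≤-trans (≤-reflexive (sym (𝟙-yes z C?))) (m≤n+m (𝟙 C?) (𝟙 B?))

  ∑-δ : ∀ n b (f : ℕ → ℕ) → b < n → ∑[ x < n ] (𝟙 (x ≟ b) * f x) ≡ f b
  ∑-δ (suc n) zero    f _ = begin
    1 * f 0 + ∑[ x < n ] (𝟙 (suc x ≟ 0) * f (suc x))  ≡⟨ cong₂ _+_ (*-identityˡ (f 0)) (∑-zero n (λ _ _ → refl)) ⟩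
    f 0 + 0                                            ≡⟨ +-identityʳ (f 0) ⟩
    f 0                                                ∎
  ∑-δ (suc n) (suc b) f (s<s b<n) = begin
    𝟙 (0 ≟ suc b) * f 0 + ∑[ x < n ] (𝟙 (suc x ≟ suc b) * f (suc x))
      ≡⟨ cong₂ _+_ (cong (_* f 0) (𝟙-no (λ ()) (0 ≟ suc b))) refl ⟩
    ∑[ x < n ] (𝟙 (suc x ≟ suc b) * f (suc x))
      ≡⟨ ∑-cong-≗ n (λ x → cong (_* f (suc x)) (𝟙-cong suc-≡ (suc x ≟ suc b) (x ≟ b))) ⟩
    ∑[ x < n ] (𝟙 (x ≟ b) * f (suc x))
      ≡⟨ ∑-δ n b (f ∘ suc) b<n ⟩
    f (suc b) ∎
    where
      suc-≡ : ∀ {x y} → (suc x ≡ suc y) ⇔ (x ≡ y)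
      suc-≡ = mk⇔ suc-injective (cong suc)

  module _ {ℓ} n b {P : ℕ → Set ℓ} (P? : ∀ x → Dec (P x)) (b<n : b < n) (Pb : P b)
           (unique : ∀ x → x < n → P x → x ≡ b) where

    ∑-unique : (f : ℕ → ℕ) → ∑[ x < n ] (𝟙 (P? x) * f x) ≡ f b
    ∑-unique f = trans (∑-cong n λ x x<n → cong (_* f x) (𝟙-cong (mk⇔ (unique x x<n) (λ { refl → Pb })) (P? x) (x ≟ b)))
                       (∑-δ n b f b<n)

    ∑-unique-count : ∑[ x < n ] 𝟙 (P? x) ≡ 1
    ∑-unique-count = trans (∑-cong-≗ n (λ x → sym (*-identityʳ (𝟙 (P? x))))) (∑-unique (λ _ → 1))

  ∑≡n⇒≡1 : ∀ n (c : ℕ → ℕ) → (∀ x → x < n → c x ≤ 1) → ∑< n c ≡ n → ∀ x → x < n → c x ≡ 1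
  ∑≡n⇒≡1 (suc n) c c≤1 ∑c≡n = λ
    { zero     _         → c0≡1
    ; (suc x) (s<s x<n) → ∑≡n⇒≡1 n (c ∘ suc) (λ y y<n → c≤1 (suc y) (s<s y<n)) rest≡n x x<n }
    where
      rest≤n : ∑< n (c ∘ suc) ≤ n
      rest≤n = ≤-trans (∑-mono-≤ n (λ y y<n → c≤1 (suc y) (s<s y<n))) (≤-reflexive (∑-count n))
      c0≡1 : c 0 ≡ 1
      c0≡1 = ≤-antisym (c≤1 0 z<s)
               (+-cancelʳ-≤ n 1 (c 0) (≤-trans (≤-reflexive (sym ∑c≡n)) (+-monoʳ-≤ (c 0) rest≤n)))
      rest≡n : ∑< n (c ∘ suc) ≡ n
      rest≡n = suc-injective (trans (cong (_+ ∑< n (c ∘ suc)) (sym c0≡1)) ∑c≡n)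

  -- Double counting: every fibre of an injective self-map of [0, n) has at most one
  -- element and the fibre sizes add up to n, so every fibre is a singleton.
  module _ n (σ : ℕ → ℕ) (σ< : ∀ x → x < n → σ x < n)
           (σ-injective : ∀ x z → x < n → z < n → σ x ≡ σ z → x ≡ z) where

    private
      fibre : ℕ → ℕ
      fibre y = ∑[ x < n ] 𝟙 (σ x ≟ y)

      fibre-swap : ∀ x y → 𝟙 (σ x ≟ y) ≡ 𝟙 (y ≟ σ x)
      fibre-swap x y = 𝟙-cong (mk⇔ sym sym) (σ x ≟ y) (y ≟ σ x)

      fibre≤1 : ∀ m (τ : ℕ → ℕ) y → (∀ x z → x < m → z < m → τ x ≡ τ z → x ≡ z) →
                ∑[ x < m ] 𝟙 (τ x ≟ y) ≤ 1
      fibre≤1 zero    τ y inj = z≤n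
      fibre≤1 (suc m) τ y inj with τ 0 ≟ y
      ... | yes τ0≡y = ≤-reflexive (cong suc (∑-zero m (λ x x<m → 𝟙-no (λ τx≡y →
              0≢1+n (inj 0 (suc x) z<s (s<s x<m) (trans τ0≡y (sym τx≡y)))) _)))
      ... | no _ = fibre≤1 m (τ ∘ suc) y
                     (λ x z x<m z<m e → suc-injective (inj (suc x) (suc z) (s<s x<m) (s<s z<m) e))

      ∑-fibre : ∀ (f : ℕ → ℕ) → ∑[ x < n ] f (σ x) ≡ ∑[ y < n ] (fibre y * f y)
      ∑-fibre f = begin
        ∑[ x < n ] f (σ x)                                ≡⟨ ∑-cong n (λ x x<n → sym (trans
                                                               (∑-cong-≗ n (λ y → cong (_* f y) (fibre-swap x y)))
                                                               (∑-δ n (σ x) f (σ< x x<n)))) ⟩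
        ∑[ x < n ] ∑[ y < n ] (𝟙 (σ x ≟ y) * f y)         ≡⟨ ∑-comm n n _ ⟩
        ∑[ y < n ] ∑[ x < n ] (𝟙 (σ x ≟ y) * f y)         ≡⟨ ∑-cong-≗ n (λ y → sym (*-distribʳ-∑ n (f y) _)) ⟩
        ∑[ y < n ] (fibre y * f y)                        ∎

      fibre≡1 : ∀ y → y < n → fibre y ≡ 1
      fibre≡1 = ∑≡n⇒≡1 n fibre (λ y _ → fibre≤1 n σ y σ-injective) (begin
        ∑[ y < n ] fibre y                 ≡⟨ ∑-cong-≗ n (λ y → sym (*-identityʳ (fibre y))) ⟩
        ∑[ y < n ] (fibre y * 1)           ≡⟨ ∑-fibre (λ _ → 1) ⟨
        ∑[ x < n ] 1                       ≡⟨ ∑-count n ⟩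
        n                                  ∎)

    ∑-reindex : ∀ (f : ℕ → ℕ) → ∑[ x < n ] f (σ x) ≡ ∑< n f
    ∑-reindex f = trans (∑-fibre f)
                        (∑-cong n (λ y y<n → trans (cong (_* f y) (fibre≡1 y y<n)) (*-identityˡ (f y))))

module Congruence where
  open import Data.Empty using (⊥-elim)
  open import Data.Integer hiding (NonZero; suc; pred; _≤_; _<_)
  open import Data.Integer.DivMod using (_%ℕ_; _/ℕ_; n%ℕd<d; a≡a%ℕn+[a/ℕn]*n)
  open import Data.Integer.Divisibility.Signed
    using (_∣?_; divides; ∣ᵤ⇒∣; ∣⇒∣ᵤ; ∣-refl; ∣-trans; ∣m⇒∣-m; ∣m∣n⇒∣m+n; ∣m∣n⇒∣m-n; ∣n⇒∣m*n; ∣m⇒∣m*n)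
  import Data.Integer.Divisibility.Signed as ℤ
  open import Data.Integer.Tactic.RingSolver using (solve-∀)
  import Data.Integer.Properties as ℤ
  open import Data.Nat as ℕ using (ℕ; zero; suc; NonZero; _≤_; _<_)
  import Data.Nat.DivMod as ℕ
  import Data.Nat.Divisibility as ℕ
  import Data.Nat.Properties as ℕ
  open import Data.Nat.Primality using (Prime; euclidsLemma)
  open import Data.Sum using (_⊎_; inj₁; inj₂)
  open import Relation.Binary.PropositionalEquality
  open import Relation.Nullary using (Dec)

  infix 4 _∣ᶻ_ _∣ᶻ?_ _≡_[mod_]

  _∣ᶻ_ : ℕ → ℤ → Set
  q ∣ᶻ X = + q ℤ.∣ X

  _∣ᶻ?_ : ∀ q X → Dec (q ∣ᶻ X)
  q ∣ᶻ? X = + q ∣? X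

  n∣ᶻn : ∀ n → n ∣ᶻ + n
  n∣ᶻn n = ∣-refl

  ∣ᶻ-respˡ : ∀ {d n X} → d ℕ.∣ n → n ∣ᶻ X → d ∣ᶻ X
  ∣ᶻ-respˡ d∣n = ∣-trans (∣ᵤ⇒∣ d∣n)

  euclidsLemmaᶻ : ∀ {p} X Y → Prime p → p ∣ᶻ X * Y → p ∣ᶻ X ⊎ p ∣ᶻ Y
  euclidsLemmaᶻ {p} X Y pr p∣XY
    with euclidsLemma ∣ X ∣ ∣ Y ∣ pr (subst (p ℕ.∣_) (ℤ.abs-* X Y) (∣⇒∣ᵤ p∣XY))
  ... | inj₁ p∣X = inj₁ (∣ᵤ⇒∣ p∣X)
  ... | inj₂ p∣Y = inj₂ (∣ᵤ⇒∣ p∣Y)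

  record _≡_[mod_] (X Y : ℤ) (n : ℕ) : Set where
    constructor ≡-mod
    field ∣-difference : n ∣ᶻ X - Y
  open _≡_[mod_] public

  module _ {n : ℕ} where

    ≡-mod-reflexive : ∀ {X Y} → X ≡ Y → X ≡ Y [mod n ]
    ≡-mod-reflexive {X} refl = ≡-mod (subst (n ∣ᶻ_) (sym (ℤ.+-inverseʳ X)) (divides 0ℤ refl))

    ≡-mod-refl : ∀ X → X ≡ X [mod n ]
    ≡-mod-refl X = ≡-mod-reflexive refl

    ≡-mod-sym : ∀ {X Y} → X ≡ Y [mod n ] → Y ≡ X [mod n ]
    ≡-mod-sym {X} {Y} (≡-mod n∣X-Y) = ≡-mod (subst (n ∣ᶻ_) (negate-difference X Y) (∣m⇒∣-m n∣X-Y))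
      where negate-difference : ∀ X Y → - (X - Y) ≡ Y - X
            negate-difference = solve-∀

    ≡-mod-trans : ∀ {X Y Z} → X ≡ Y [mod n ] → Y ≡ Z [mod n ] → X ≡ Z [mod n ]
    ≡-mod-trans {X} {Y} {Z} (≡-mod n∣X-Y) (≡-mod n∣Y-Z) = ≡-mod (subst (n ∣ᶻ_) (telescope X Y Z) (∣m∣n⇒∣m+n n∣X-Y n∣Y-Z))
      where telescope : ∀ X Y Z → (X - Y) + (Y - Z) ≡ X - Z
            telescope = solve-∀

    +-cong-mod : ∀ {X X′ Y Y′} → X ≡ X′ [mod n ] → Y ≡ Y′ [mod n ] → X + Y ≡ X′ + Y′ [mod n ]
    +-cong-mod {X} {X′} {Y} {Y′} (≡-mod n∣X) (≡-mod n∣Y) = ≡-mod (subst (n ∣ᶻ_) (regroup X X′ Y Y′) (∣m∣n⇒∣m+n n∣X n∣Y))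
      where regroup : ∀ X X′ Y Y′ → (X - X′) + (Y - Y′) ≡ (X + Y) - (X′ + Y′)
            regroup = solve-∀

    *-cong-mod : ∀ {X X′ Y Y′} → X ≡ X′ [mod n ] → Y ≡ Y′ [mod n ] → X * Y ≡ X′ * Y′ [mod n ]
    *-cong-mod {X} {X′} {Y} {Y′} (≡-mod n∣X) (≡-mod n∣Y) =
      ≡-mod (subst (n ∣ᶻ_) (regroup X X′ Y Y′) (∣m∣n⇒∣m+n (∣n⇒∣m*n X n∣Y) (∣m⇒∣m*n Y′ n∣X)))
      where regroup : ∀ X X′ Y Y′ → X * (Y - Y′) + (X - X′) * Y′ ≡ X * Y - X′ * Y′
            regroup = solve-∀

    -‿cong-mod : ∀ {X X′} → X ≡ X′ [mod n ] → - X ≡ - X′ [mod n ]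
    -‿cong-mod {X} {X′} (≡-mod n∣X) = ≡-mod (subst (n ∣ᶻ_) (regroup X X′) (∣m⇒∣-m n∣X))
      where regroup : ∀ X X′ → - (X - X′) ≡ (- X) - (- X′)
            regroup = solve-∀

    -‿cong-mod₂ : ∀ {X X′ Y Y′} → X ≡ X′ [mod n ] → Y ≡ Y′ [mod n ] → X - Y ≡ X′ - Y′ [mod n ]
    -‿cong-mod₂ X≡X′ Y≡Y′ = +-cong-mod X≡X′ (-‿cong-mod Y≡Y′)

    ∣ᶻ-resp-≡mod : ∀ {X Y} → X ≡ Y [mod n ] → n ∣ᶻ X → n ∣ᶻ Y
    ∣ᶻ-resp-≡mod {X} {Y} (≡-mod n∣X-Y) n∣X = subst (n ∣ᶻ_) (cancel X Y) (∣m∣n⇒∣m-n n∣X n∣X-Y)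
      where cancel : ∀ X Y → X - (X - Y) ≡ Y
            cancel = solve-∀

    ∣ᶻ⇒≡0-mod : ∀ {X} → n ∣ᶻ X → X ≡ 0ℤ [mod n ]
    ∣ᶻ⇒≡0-mod {X} n∣X = ≡-mod (subst (n ∣ᶻ_) (sym (ℤ.+-identityʳ X)) n∣X)

    +n≡-mod : ∀ a → + (a ℕ.+ n) ≡ + a [mod n ]
    +n≡-mod a = ≡-mod (subst (n ∣ᶻ_) (sym (trans (cong (_- + a) (ℤ.pos-+ a n)) (cancel (+ a) (+ n)))) (n∣ᶻn n))
      where cancel : ∀ X Y → X + Y - X ≡ Y
            cancel = solve-∀

    ≡-mod-respˡ : ∀ {d X Y} → d ℕ.∣ n → X ≡ Y [mod n ] → X ≡ Y [mod d ]
    ≡-mod-respˡ d∣n (≡-mod n∣X-Y) = ≡-mod (∣ᶻ-respˡ d∣n n∣X-Y)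

    private
      ≡-mod-≤⇒≡ : ∀ {x y} → x < n → y ≤ x → + x ≡ + y [mod n ] → x ≡ y
      ≡-mod-≤⇒≡ {x} {y} x<n y≤x (≡-mod n∣x-y) = ℕ.≤-antisym (ℕ.m∸n≡0⇒m≤n (x∸y≡0 (x ℕ.∸ y) refl)) y≤x
        where
          n∣x∸y : n ℕ.∣ x ℕ.∸ y
          n∣x∸y = subst (λ z → n ℕ.∣ ∣ z ∣) (trans (ℤ.m-n≡m⊖n x y) (ℤ.⊖-≥ y≤x)) (∣⇒∣ᵤ n∣x-y)
          x∸y≡0 : ∀ k → x ℕ.∸ y ≡ k → k ≡ 0
          x∸y≡0 zero    _  = refl
          x∸y≡0 (suc k) eq = ⊥-elim (ℕ.<⇒≱ x<n (ℕ.≤-trans (ℕ.∣⇒≤ (subst (n ℕ.∣_) eq n∣x∸y))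
                                                         (subst (ℕ._≤ x) eq (ℕ.m∸n≤m x y))))

    ≡-mod⇒≡ : ∀ {x y} → x < n → y < n → + x ≡ + y [mod n ] → x ≡ y
    ≡-mod⇒≡ {x} {y} x<n y<n x≡y with ℕ.≤-total y x
    ... | inj₁ y≤x = ≡-mod-≤⇒≡ x<n y≤x x≡y
    ... | inj₂ x≤y = sym (≡-mod-≤⇒≡ y<n x≤y (≡-mod-sym x≡y))

  module _ (n : ℕ) .{{_ : NonZero n}} where

    private
      remainder : ∀ r q N → r - (r + q * N) ≡ (- q) * N
      remainder = solve-∀

    %ℕ-≡mod : ∀ X → + (X %ℕ n) ≡ X [mod n ]
    %ℕ-≡mod X = ≡-mod (divides (- (X /ℕ n))
      (trans (cong (_-_ (+ (X %ℕ n))) (a≡a%ℕn+[a/ℕn]*n X n)) (remainder (+ (X %ℕ n)) (X /ℕ n) (+ n))))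

    %-≡mod : ∀ x → + (x ℕ.% n) ≡ + x [mod n ]
    %-≡mod x = ≡-mod (divides (- (+ (x ℕ./ n)))
      (trans (cong (_-_ (+ (x ℕ.% n))) (trans (cong +_ (ℕ.m≡m%n+[m/n]*n x n))
                                     (trans (ℤ.pos-+ (x ℕ.% n) _) (cong (_+_ (+ (x ℕ.% n))) (ℤ.pos-* (x ℕ./ n) n)))))
             (remainder (+ (x ℕ.% n)) (+ (x ℕ./ n)) (+ n))))

    %ℕ-unique : ∀ {X a} → X ≡ + a [mod n ] → a < n → X %ℕ n ≡ a
    %ℕ-unique {X} X≡a a<n = ≡-mod⇒≡ (n%ℕd<d X n) a<n (≡-mod-trans (%ℕ-≡mod X) X≡a)

module PrimeDivisors where
  open import Data.Empty using (⊥-elim)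
  open import Data.Integer using (ℤ; ∣_∣)
  open import Data.Integer.Divisibility.Signed using (∣⇒∣ᵤ; ∣ᵤ⇒∣)
  open import Data.List using ([]; _∷_)
  open import Data.List.Relation.Unary.All using (_∷_)
  open import Data.Nat using (ℕ; NonZero; _*_; _<_; _≟_; ≢-nonZero; ≢-nonZero⁻¹; nonTrivial⇒n>1)
  open import Data.Nat.Properties using (<-irrefl)
  open import Data.Nat.Divisibility
  open import Data.Nat.GCD using (gcd; gcd[m,n]∣m; gcd[m,n]∣n; gcd-greatest; gcd[m,n]≢0)
  open import Data.Nat.ListAction using (product)
  open import Data.Nat.Coprimality using (Coprime)
  open import Data.Nat.Primality using (Prime; euclidsLemma; prime⇒irreducible; prime⇒nonTrivial)
  open import Data.Nat.Primality.Factorisation using (factorise)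
  open import Data.Product using (Σ-syntax; _×_; _,_)
  open import Data.Sum using (inj₁; inj₂; [_,_]′)
  open import Function using (_⇔_; mk⇔)
  open import Relation.Binary.PropositionalEquality
  open import Relation.Nullary using (¬_; yes; no)
  open Congruence

  prime>1 : ∀ {p} → Prime p → 1 < p
  prime>1 {p} p-prime = nonTrivial⇒n>1 p {{prime⇒nonTrivial p-prime}}

  prime≢1 : ∀ {p} → Prime p → p ≢ 1
  prime≢1 p-prime refl = <-irrefl refl (prime>1 p-prime)

  prime∣prime⇒≡ : ∀ {q p} → Prime q → Prime p → q ∣ p → q ≡ p
  prime∣prime⇒≡ q-prime p-prime q∣p with prime⇒irreducible p-prime q∣p
  ... | inj₁ q≡1 = ⊥-elim (prime≢1 q-prime q≡1)
  ... | inj₂ q≡p = q≡p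

  prime-factor : ∀ n → .{{NonZero n}} → n ≢ 1 → Σ[ q ∈ ℕ ] Prime q × q ∣ n
  prime-factor n n≢1 with factorise n
  ... | record { factors = [] ; isFactorisation = n≡1 } = ⊥-elim (n≢1 n≡1)
  ... | record { factors = q ∷ qs ; isFactorisation = n≡q*qs ; factorsPrime = q-prime ∷ _ } =
    q , q-prime , subst (q ∣_) (sym n≡q*qs) (m∣m*n (product qs))

  prime∤⇒coprime : ∀ {p k} → Prime p → ¬ p ∣ k → Coprime p k
  prime∤⇒coprime p-prime p∤k (d∣p , d∣k) with prime⇒irreducible p-prime d∣p
  ... | inj₁ d≡1  = d≡1
  ... | inj₂ refl = ⊥-elim (p∤k d∣k)

  NoCommonPrime : ℕ → ℤ → Set
  NoCommonPrime n X = ∀ q → Prime q → q ∣ n → ¬ q ∣ᶻ X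

  gcd≡1⇔noCommonPrime : ∀ n X → .{{NonZero n}} → gcd ∣ X ∣ n ≡ 1 ⇔ NoCommonPrime n X
  gcd≡1⇔noCommonPrime n X = mk⇔ gcd≡1⇒ ⇒gcd≡1
    where
      gcd≡1⇒ : gcd ∣ X ∣ n ≡ 1 → NoCommonPrime n X
      gcd≡1⇒ gcd≡1 q q-prime q∣n q∣X =
        prime≢1 q-prime (∣1⇒≡1 (subst (q ∣_) gcd≡1 (gcd-greatest (∣⇒∣ᵤ q∣X) q∣n)))
      gcd≢0 : NonZero (gcd ∣ X ∣ n)
      gcd≢0 = ≢-nonZero (gcd[m,n]≢0 ∣ X ∣ n (inj₂ (≢-nonZero⁻¹ n)))
      ⇒gcd≡1 : NoCommonPrime n X → gcd ∣ X ∣ n ≡ 1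
      ⇒gcd≡1 none with gcd ∣ X ∣ n ≟ 1
      ... | yes gcd≡1 = gcd≡1
      ... | no gcd≢1 with prime-factor (gcd ∣ X ∣ n) {{gcd≢0}} gcd≢1
      ...   | q , q-prime , q∣gcd = ⊥-elim (none q q-prime (∣-trans q∣gcd (gcd[m,n]∣n ∣ X ∣ n))
                                                     (∣ᵤ⇒∣ (∣-trans q∣gcd (gcd[m,n]∣m ∣ X ∣ n))))

  module _ {n : ℕ} {X : ℤ} where

    noCommonPrime-≡mod⇔ : ∀ {Y} → X ≡ Y [mod n ] → NoCommonPrime n X ⇔ NoCommonPrime n Y
    noCommonPrime-≡mod⇔ X≡Y = mk⇔
      (λ none q q-prime q∣n q∣Y → none q q-prime q∣n (∣ᶻ-resp-≡mod (≡-mod-respˡ q∣n (≡-mod-sym X≡Y)) q∣Y))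
      (λ none q q-prime q∣n q∣X → none q q-prime q∣n (∣ᶻ-resp-≡mod (≡-mod-respˡ q∣n X≡Y) q∣X))

    noCommonPrime-mono : ∀ {n′} → (∀ q → Prime q → q ∣ n → q ∣ n′) → NoCommonPrime n′ X → NoCommonPrime n X
    noCommonPrime-mono n⊆n′ none q q-prime q∣n = none q q-prime (n⊆n′ q q-prime q∣n)

  noCommonPrime-*⇔ : ∀ d e X → NoCommonPrime (d * e) X ⇔ (NoCommonPrime d X × NoCommonPrime e X)
  noCommonPrime-*⇔ d e X = mk⇔
    (λ none → noCommonPrime-mono (λ q _ q∣d → ∣-trans q∣d (m∣m*n e)) none
            , noCommonPrime-mono (λ q _ q∣e → ∣-trans q∣e (n∣m*n d)) none)
    (λ (none-d , none-e) q q-prime q∣de → [ none-d q q-prime , none-e q q-prime ]′ (euclidsLemma d e q-prime q∣de))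

  noCommonPrime-prime⇔ : ∀ {p} X → Prime p → NoCommonPrime p X ⇔ (¬ p ∣ᶻ X)
  noCommonPrime-prime⇔ X p-prime = mk⇔
    (λ none → none _ p-prime ∣-refl)
    (λ p∤X q q-prime q∣p → subst (λ r → ¬ r ∣ᶻ X) (sym (prime∣prime⇒≡ q-prime p-prime q∣p)) p∤X)

module ResidueSums where
  open import Data.Integer using (+_; _-_; ∣_∣; 0ℤ) renaming (_*_ to _*ᶻ_; _+_ to _+ᶻ_)
  open import Data.Integer.Divisibility.Signed using (∣⇒∣ᵤ; ∣ᵤ⇒∣; divides)
  open import Data.Integer.DivMod using (_%ℕ_; n%ℕd<d)
  open import Data.Integer.Tactic.RingSolver using (solve-∀)
  import Data.Integer.Properties as ℤ
  open import Data.Nat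
  open import Data.Nat.Coprimality using (Coprime; coprime-divisor)
  open import Data.Nat.DivMod
  open import Data.Nat.Divisibility using (_∣_)
  open import Data.Nat.Properties
  open import Function using (mk⇔)
  open import Relation.Binary.PropositionalEquality
  open Sums
  open Congruence
  open ≡-Reasoning

  Periodic : ℕ → (ℕ → ℕ) → Set
  Periodic d f = ∀ x → f (x + d) ≡ f x

  module _ {d} {f : ℕ → ℕ} (f-periodic : Periodic d f) where

    periodic-*+ : ∀ k i → f (k * d + i) ≡ f i
    periodic-*+ zero    i = refl
    periodic-*+ (suc k) i = begin
      f (d + k * d + i)  ≡⟨ cong f (trans (+-assoc d (k * d) i) (+-comm d _)) ⟩
      f (k * d + i + d)  ≡⟨ f-periodic _ ⟩
      f (k * d + i)      ≡⟨ periodic-*+ k i ⟩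
      f i                ∎

    periodic-% : .{{_ : NonZero d}} → ∀ x → f x ≡ f (x % d)
    periodic-% x = trans (cong f (trans (m≡m%n+[m/n]*n x d) (+-comm (x % d) _))) (periodic-*+ (x / d) (x % d))

    ∑-periodic : ∀ k → ∑< (k * d) f ≡ k * ∑< d f
    ∑-periodic k = begin
      ∑< (k * d) f                        ≡⟨ ∑-blocks k d f ⟩
      ∑[ j < k ] ∑[ i < d ] f (j * d + i) ≡⟨ ∑-cong-≗ k (λ j → ∑-cong-≗ d (periodic-*+ j)) ⟩
      ∑[ j < k ] ∑< d f                   ≡⟨ ∑-const k (∑< d f) ⟩
      k * ∑< d f                          ∎

  ∑-affine : ∀ d e i .{{_ : NonZero d}} → Coprime d e → (F : ℕ → ℕ) → Periodic d F →
             ∑[ k < d ] F (k * e + i) ≡ ∑< d F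
  ∑-affine d e i d⊥e F F-periodic = begin
    ∑[ k < d ] F (k * e + i)          ≡⟨ ∑-cong-≗ d (λ k → periodic-% F-periodic (k * e + i)) ⟩
    ∑[ k < d ] F ((k * e + i) % d)    ≡⟨ ∑-reindex d (λ k → (k * e + i) % d) (λ x _ → m%n<n _ d) injective F ⟩
    ∑< d F                            ∎
    where
      ℤ-form : ∀ k → + (k * e + i) ≡ + k *ᶻ + e +ᶻ + i
      ℤ-form k = trans (ℤ.pos-+ (k * e) i) (cong (_+ᶻ + i) (ℤ.pos-* k e))
      difference : ∀ x z e i → (x *ᶻ e +ᶻ i) - (z *ᶻ e +ᶻ i) ≡ (x - z) *ᶻ e
      difference = solve-∀
      injective : ∀ x z → x < d → z < d → (x * e + i) % d ≡ (z * e + i) % d → x ≡ z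
      injective x z x<d z<d eq = ≡-mod⇒≡ x<d z<d (≡-mod (∣ᵤ⇒∣ d∣x-z))
        where
          images : + (x * e + i) ≡ + (z * e + i) [mod d ]
          images = ≡-mod-trans (≡-mod-sym (%-≡mod d (x * e + i)))
                     (≡-mod-trans (≡-mod-reflexive (cong +_ eq)) (%-≡mod d (z * e + i)))
          d∣[x-z]e : d ∣ ∣ (+ x - + z) *ᶻ + e ∣
          d∣[x-z]e = ∣⇒∣ᵤ (subst (d ∣ᶻ_) (trans (cong₂ _-_ (ℤ-form x) (ℤ-form z)) (difference (+ x) (+ z) (+ e) (+ i)))
                                          (∣-difference images))
          d∣x-z : d ∣ ∣ (+ x - + z) ∣
          d∣x-z = coprime-divisor d⊥e (subst (d ∣_) (trans (ℤ.abs-* (+ x - + z) (+ e)) (*-comm _ e)) d∣[x-z]e)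

  ∑-CRT : ∀ d e .{{_ : NonZero d}} → Coprime d e → (F H : ℕ → ℕ) → Periodic d F → Periodic e H →
          ∑[ x < d * e ] (F x * H x) ≡ ∑< d F * ∑< e H
  ∑-CRT d e d⊥e F H F-periodic H-periodic = begin
    ∑[ x < d * e ] (F x * H x)
      ≡⟨ ∑-blocks d e _ ⟩
    ∑[ k < d ] ∑[ i < e ] (F (k * e + i) * H (k * e + i))
      ≡⟨ ∑-cong-≗ d (λ k → ∑-cong-≗ e (λ i →
         cong (F (k * e + i) *_) (periodic-*+ H-periodic k i))) ⟩
    ∑[ k < d ] ∑[ i < e ] (F (k * e + i) * H i)
      ≡⟨ ∑-comm d e _ ⟩
    ∑[ i < e ] ∑[ k < d ] (F (k * e + i) * H i)
      ≡⟨ ∑-cong-≗ e (λ i → sym (*-distribʳ-∑ d (H i) _)) ⟩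
    ∑[ i < e ] (∑[ k < d ] F (k * e + i) * H i)
      ≡⟨ ∑-cong-≗ e (λ i → cong (_* H i) (∑-affine d e i d⊥e F F-periodic)) ⟩
    ∑[ i < e ] (∑< d F * H i)
      ≡⟨ *-distribˡ-∑ e (∑< d F) H ⟨
    ∑< d F * ∑< e H ∎

  module _ n .{{_ : NonZero n}} where

    ∑-≡mod : ∀ K (f : ℕ → ℕ) → ∑[ x < n ] (𝟙 (n ∣ᶻ? (K - + x)) * f x) ≡ f (K %ℕ n)
    ∑-≡mod K f = ∑-unique n (K %ℕ n) (λ x → n ∣ᶻ? (K - + x)) (n%ℕd<d K n)
      (∣-difference (≡-mod-sym (%ℕ-≡mod n K))) (λ x x<n n∣K-x → sym (%ℕ-unique n {K} (≡-mod n∣K-x) x<n)) f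

    residue-periodic : ∀ K → Periodic n (λ x → 𝟙 (n ∣ᶻ? (K - + x)))
    residue-periodic K x = 𝟙-cong (mk⇔ (∣ᶻ-resp-≡mod shift) (∣ᶻ-resp-≡mod (≡-mod-sym shift))) (n ∣ᶻ? _) (n ∣ᶻ? _)
      where shift : K - + (x + n) ≡ K - + x [mod n ]
            shift = -‿cong-mod₂ (≡-mod-refl K) (+n≡-mod x)

    ∑-≡mod-count : ∀ K → ∑[ x < n ] 𝟙 (n ∣ᶻ? (K - + x)) ≡ 1
    ∑-≡mod-count K = trans (∑-cong-≗ n (λ x → sym (*-identityʳ _))) (∑-≡mod K (λ _ → 1))

    ∑-∣ : ∀ (f : ℕ → ℕ) → ∑[ x < n ] (𝟙 (n ∣ᶻ? + x) * f x) ≡ f 0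
    ∑-∣ f = ∑-unique n 0 (λ x → n ∣ᶻ? + x) (>-nonZero⁻¹ n) (divides 0ℤ refl)
      (λ x x<n n∣x → ≡-mod⇒≡ x<n (>-nonZero⁻¹ n) (∣ᶻ⇒≡0-mod n∣x)) f

    ∑-∣-count : ∑[ x < n ] 𝟙 (n ∣ᶻ? + x) ≡ 1
    ∑-∣-count = trans (∑-cong-≗ n (λ x → sym (*-identityʳ _))) (∑-∣ (λ _ → 1))

module ListCounting {A : Set} {P : A → Set} (P? : ∀ x → Dec (P x)) where
  open import Data.List using (List; filter; length; map; concatMap; applyUpTo; _++_)
  open import Data.List.Properties using (filter-++; length-++)
  open import Data.Nat using (ℕ; zero; suc; _+_)
  open import Function using (_∘_)
  open import Relation.Binary.PropositionalEquality
  open Sums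

  count-map : ∀ (k : ℕ → A) h n → length (filter P? (map k (applyUpTo h n))) ≡ ∑[ x < n ] 𝟙 (P? (k (h x)))
  count-map k h zero = refl
  count-map k h (suc n) with P? (k (h 0))
  ... | yes _ = cong suc (count-map k (h ∘ suc) n)
  ... | no  _ = count-map k (h ∘ suc) n

  count-concatMap : ∀ {B : Set} (g : B → List A) (h : ℕ → B) n →
    length (filter P? (concatMap g (applyUpTo h n))) ≡ ∑[ x < n ] length (filter P? (g (h x)))
  count-concatMap g h zero = refl
  count-concatMap g h (suc n) = begin
    length (filter P? (g (h 0) ++ rest))
      ≡⟨ cong length (filter-++ P? (g (h 0)) rest) ⟩
    length (filter P? (g (h 0)) ++ filter P? rest)
      ≡⟨ length-++ (filter P? (g (h 0))) ⟩
    length (filter P? (g (h 0))) + length (filter P? rest)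
      ≡⟨ cong (length (filter P? (g (h 0))) +_) (count-concatMap g (h ∘ suc) n) ⟩
    length (filter P? (g (h 0))) + ∑[ x < n ] length (filter P? (g (h (suc x)))) ∎
    where
      open ≡-Reasoning
      rest = concatMap g (applyUpTo (h ∘ suc) n)

module PairCount (m : ℕ) where
  open import Data.Integer hiding (NonZero; suc; pred; _≤_; _<_; _≟_)
  import Data.Integer.Properties as ℤ
  open import Data.Integer.Divisibility.Signed using (∣ᵤ⇒∣; ∣⇒∣ᵤ)
  open import Data.Integer.DivMod using (_%ℕ_; n%ℕd<d)
  open import Data.Integer.Tactic.RingSolver using (solve-∀)
  open import Data.Nat as ℕ using (ℕ; NonZero; _<_; _≟_)
  open import Data.Nat.Coprimality using (Coprime)
  open import Data.Nat.Properties using (*-assoc; +-identityʳ; m*n≢0)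
  open import Data.Nat.Divisibility as ℕ using (n∣m*n)
  open import Data.Nat.GCD using (gcd; gcd-zeroʳ)
  open import Data.Nat.Primality using (Prime)
  open import Data.List using (filter; length; map; concatMap; upTo)
  open import Data.Product using (_×_; _,_)
  open import Data.Product.Function.NonDependent.Propositional using (_×-⇔_)
  open import Function using (_⇔_; mk⇔; id)
  open import Function.Properties.Equivalence using () renaming (trans to ⇔-trans; sym to ⇔-sym)
  open import Relation.Binary.PropositionalEquality
  open import Relation.Nullary using (Dec)
  open import Relation.Nullary.Decidable using (_×-dec_)
  open Defs using (g₃; good?)
  open Sums
  open Congruence
  open PrimeDivisors
  open ResidueSums
  open ≡-Reasoning

  third : ℤ → ℤ → ℤ
  third a b = + m - a - b

  e₂ e₃ : ℤ → ℤ → ℤ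
  e₂ a b = a * b + b * third a b + third a b * a
  e₃ a b = a * b * third a b

  module _ {n a a′ b b′} (a≡a′ : a ≡ a′ [mod n ]) (b≡b′ : b ≡ b′ [mod n ]) where

    third-cong-mod : third a b ≡ third a′ b′ [mod n ]
    third-cong-mod = -‿cong-mod₂ (-‿cong-mod₂ (≡-mod-refl (+ m)) a≡a′) b≡b′

    e₂-cong-mod : e₂ a b ≡ e₂ a′ b′ [mod n ]
    e₂-cong-mod = +-cong-mod (+-cong-mod (*-cong-mod a≡a′ b≡b′) (*-cong-mod b≡b′ third-cong-mod))
                             (*-cong-mod third-cong-mod a≡a′)

    e₃-cong-mod : e₃ a b ≡ e₃ a′ b′ [mod n ]
    e₃-cong-mod = *-cong-mod (*-cong-mod a≡a′ b≡b′) third-cong-mod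

  Admissible : ℕ → ℤ → ℤ → Set
  Admissible n a b = NoCommonPrime n (e₃ a b) × NoCommonPrime n (e₂ a b)

  AdmissibleGcd : ℕ → ℕ → ℕ → Set
  AdmissibleGcd n a b = (gcd ∣ e₃ (+ a) (+ b) ∣ n ≡ 1) × (gcd ∣ e₂ (+ a) (+ b) ∣ n ≡ 1)

  admissible? : ∀ n a b → Dec (AdmissibleGcd n a b)
  admissible? n a b = (gcd ∣ e₃ (+ a) (+ b) ∣ n ≟ 1) ×-dec (gcd ∣ e₂ (+ a) (+ b) ∣ n ≟ 1)

  admissibleGcd⇔ : ∀ n a b → .{{_ : NonZero n}} → AdmissibleGcd n a b ⇔ Admissible n (+ a) (+ b)
  admissibleGcd⇔ n a b = gcd≡1⇔noCommonPrime n _ ×-⇔ gcd≡1⇔noCommonPrime n _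

  admissible-≡mod⇔ : ∀ {n a a′ b b′} → a ≡ a′ [mod n ] → b ≡ b′ [mod n ] → Admissible n a b ⇔ Admissible n a′ b′
  admissible-≡mod⇔ a≡a′ b≡b′ =
    noCommonPrime-≡mod⇔ (e₃-cong-mod a≡a′ b≡b′) ×-⇔ noCommonPrime-≡mod⇔ (e₂-cong-mod a≡a′ b≡b′)

  Φ : ℕ → ℕ → ℕ → ℕ
  Φ n a b = 𝟙 (admissible? n a b)

  G : ℕ → ℕ
  G n = ∑[ a < n ] ∑[ b < n ] Φ n a b

  module _ n .{{_ : NonZero n}} where

    Φ-char : ∀ a b {A : Set} (d : Dec A) → A ⇔ Admissible n (+ a) (+ b) → Φ n a b ≡ 𝟙 d
    Φ-char a b d A⇔ = 𝟙-cong (⇔-trans (admissibleGcd⇔ n a b) (⇔-sym A⇔)) (admissible? n a b) d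

    Φ-cong-mod : ∀ {a a′ b b′} → + a ≡ + a′ [mod n ] → + b ≡ + b′ [mod n ] → Φ n a b ≡ Φ n a′ b′
    Φ-cong-mod {a} {a′} {b} {b′} a≡a′ b≡b′ =
      Φ-char a b (admissible? n a′ b′) (⇔-trans (admissibleGcd⇔ n a′ b′) (⇔-sym (admissible-≡mod⇔ a≡a′ b≡b′)))

    Φ-periodicˡ : ∀ b → Periodic n (λ a → Φ n a b)
    Φ-periodicˡ b a = Φ-cong-mod (+n≡-mod a) (≡-mod-refl (+ b))

    Φ-periodicʳ : ∀ a → Periodic n (Φ n a)
    Φ-periodicʳ a b = Φ-cong-mod (≡-mod-refl (+ a)) (+n≡-mod b)

    rows-periodic : Periodic n (λ a → ∑< n (Φ n a))
    rows-periodic a = ∑-cong-≗ n (λ b → Φ-periodicˡ b a)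

  Φ-* : ∀ d e a b .{{_ : NonZero d}} .{{_ : NonZero e}} → Φ (d ℕ.* e) a b ≡ Φ d a b ℕ.* Φ e a b
  Φ-* d e a b = trans
    (Φ-char (d ℕ.* e) {{m*n≢0 d e}} a b (admissible? d a b ×-dec admissible? e a b)
      (⇔-trans (admissibleGcd⇔ d a b ×-⇔ admissibleGcd⇔ e a b) (mk⇔
        (λ ((e₃-d , e₂-d) , (e₃-e , e₂-e)) → Equivalence.from (noCommonPrime-*⇔ d e _) (e₃-d , e₃-e)
                                           , Equivalence.from (noCommonPrime-*⇔ d e _) (e₂-d , e₂-e))
        (λ (e₃-de , e₂-de) → let (e₃-d , e₃-e) = Equivalence.to (noCommonPrime-*⇔ d e _) e₃-de
                                 (e₂-d , e₂-e) = Equivalence.to (noCommonPrime-*⇔ d e _) e₂-de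
                             in (e₃-d , e₂-d) , (e₃-e , e₂-e)))))
    (𝟙-× (admissible? d a b) (admissible? e a b))
    where open Function using (Equivalence)

  G-* : ∀ d e .{{_ : NonZero d}} .{{_ : NonZero e}} → Coprime d e → G (d ℕ.* e) ≡ G d ℕ.* G e
  G-* d e d⊥e = begin
    ∑[ a < d ℕ.* e ] ∑[ b < d ℕ.* e ] Φ (d ℕ.* e) a b
      ≡⟨ ∑-cong-≗ (d ℕ.* e) (λ a → ∑-cong-≗ (d ℕ.* e) (λ b → Φ-* d e a b)) ⟩
    ∑[ a < d ℕ.* e ] ∑[ b < d ℕ.* e ] (Φ d a b ℕ.* Φ e a b)
      ≡⟨ ∑-cong-≗ (d ℕ.* e) (λ a → ∑-CRT d e d⊥e (Φ d a) (Φ e a) (Φ-periodicʳ d a) (Φ-periodicʳ e a)) ⟩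
    ∑[ a < d ℕ.* e ] (∑< d (Φ d a) ℕ.* ∑< e (Φ e a))
      ≡⟨ ∑-CRT d e d⊥e _ _ (rows-periodic d) (rows-periodic e) ⟩
    G d ℕ.* G e  ∎

  G-lift : ∀ k n .{{_ : NonZero k}} .{{_ : NonZero n}} → (∀ q → Prime q → q ℕ.∣ k ℕ.* n → q ℕ.∣ n) →
           G (k ℕ.* n) ≡ k ℕ.* k ℕ.* G n
  G-lift k n radical = begin
    ∑[ a < k ℕ.* n ] ∑[ b < k ℕ.* n ] Φ (k ℕ.* n) a b  ≡⟨ ∑-cong-≗ (k ℕ.* n) (λ a → ∑-cong-≗ (k ℕ.* n) (same-radical a)) ⟩
    ∑[ a < k ℕ.* n ] ∑< (k ℕ.* n) (Φ n a)             ≡⟨ ∑-cong-≗ (k ℕ.* n) (λ a → ∑-periodic (Φ-periodicʳ n a) k) ⟩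
    ∑[ a < k ℕ.* n ] (k ℕ.* ∑< n (Φ n a))             ≡⟨ *-distribˡ-∑ (k ℕ.* n) k _ ⟨
    k ℕ.* ∑[ a < k ℕ.* n ] ∑< n (Φ n a)               ≡⟨ cong (k ℕ.*_) (∑-periodic (rows-periodic n) k) ⟩
    k ℕ.* (k ℕ.* G n)                                 ≡⟨ *-assoc k k (G n) ⟨
    k ℕ.* k ℕ.* G n                                   ∎
    where
      same-radical : ∀ a b → Φ (k ℕ.* n) a b ≡ Φ n a b
      same-radical a b = Φ-char (k ℕ.* n) {{m*n≢0 k n}} a b (admissible? n a b) (⇔-trans (admissibleGcd⇔ n a b) (mk⇔
        (λ (e₃-n , e₂-n) → noCommonPrime-mono radical e₃-n , noCommonPrime-mono radical e₂-n)
        (λ (e₃-kn , e₂-kn) → let n⊆kn = λ q _ q∣n → ℕ.∣-trans q∣n (n∣m*n k)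
                             in noCommonPrime-mono n⊆kn e₃-kn , noCommonPrime-mono n⊆kn e₂-kn)))

  G-1 : G 1 ≡ 1
  G-1 = trans (+-identityʳ (∑< 1 (Φ 1 0))) (trans (+-identityʳ (Φ 1 0 0))
        (𝟙-yes (gcd-zeroʳ ∣ e₃ 0ℤ 0ℤ ∣ , gcd-zeroʳ ∣ e₂ 0ℤ 0ℤ ∣) (admissible? 1 0 0)))

  ∑-good≡Φ : ∀ n .{{_ : NonZero n}} a b → ∑[ c < n ] 𝟙 (good? m n (a , b , c)) ≡ Φ n a b
  ∑-good≡Φ n a b = begin
    ∑[ c < n ] 𝟙 (good? m n (a , b , c))               ≡⟨ ∑-cong-≗ n (λ c → 𝟙-× (sums-to-m? c) (coprime? c)) ⟩
    ∑[ c < n ] (𝟙 (sums-to-m? c) ℕ.* 𝟙 (coprime? c))   ≡⟨ ∑-unique n c₀ sums-to-m? (n%ℕd<d (third (+ a) (+ b)) n)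
                                                            c₀-sums-to-m unique (λ c → 𝟙 (coprime? c)) ⟩
    𝟙 (coprime? c₀)                                     ≡⟨ Φ-char n a b (coprime? c₀) c₀-coprime⇔ ⟨
    Φ n a b                                             ∎
    where
      sums-to-m? : ∀ c → Dec (n ℕ.∣ ∣ + (a ℕ.+ b ℕ.+ c) - + m ∣)
      sums-to-m? c = n ℕ.∣? ∣ + (a ℕ.+ b ℕ.+ c) - + m ∣
      coprime? : ∀ c → Dec ((gcd (a ℕ.* b ℕ.* c) n ≡ 1) × (gcd (a ℕ.* b ℕ.+ b ℕ.* c ℕ.+ c ℕ.* a) n ≡ 1))
      coprime? c = (gcd (a ℕ.* b ℕ.* c) n ≟ 1) ×-dec (gcd (a ℕ.* b ℕ.+ b ℕ.* c ℕ.+ c ℕ.* a) n ≟ 1)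
      c₀ : ℕ
      c₀ = third (+ a) (+ b) %ℕ n
      c₀≡third : + c₀ ≡ third (+ a) (+ b) [mod n ]
      c₀≡third = %ℕ-≡mod n (third (+ a) (+ b))
      sum-form : ∀ c → + c - third (+ a) (+ b) ≡ + (a ℕ.+ b ℕ.+ c) - + m
      sum-form c = trans (shift (+ a) (+ b) (+ c) (+ m))
                         (cong (_- + m) (sym (trans (ℤ.pos-+ (a ℕ.+ b) c) (cong (_+ + c) (ℤ.pos-+ a b)))))
        where shift : ∀ a b c M → c - (M - a - b) ≡ a + b + c - M
              shift = solve-∀
      c₀-sums-to-m : n ℕ.∣ ∣ + (a ℕ.+ b ℕ.+ c₀) - + m ∣
      c₀-sums-to-m = ∣⇒∣ᵤ (subst (n ∣ᶻ_) (sum-form c₀) (∣-difference c₀≡third))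
      unique : ∀ c → c < n → n ℕ.∣ ∣ + (a ℕ.+ b ℕ.+ c) - + m ∣ → c ≡ c₀
      unique c c<n n∣ = sym (%ℕ-unique n {third (+ a) (+ b)} (≡-mod-sym (≡-mod (subst (n ∣ᶻ_) (sym (sum-form c)) (∣ᵤ⇒∣ n∣)))) c<n)
      e₃≡ : + (a ℕ.* b ℕ.* c₀) ≡ e₃ (+ a) (+ b) [mod n ]
      e₃≡ = ≡-mod-trans (≡-mod-reflexive (trans (ℤ.pos-* (a ℕ.* b) c₀) (cong (_* + c₀) (ℤ.pos-* a b))))
                        (*-cong-mod (≡-mod-refl (+ a * + b)) c₀≡third)
      e₂≡ : + (a ℕ.* b ℕ.+ b ℕ.* c₀ ℕ.+ c₀ ℕ.* a) ≡ e₂ (+ a) (+ b) [mod n ]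
      e₂≡ = ≡-mod-trans (≡-mod-reflexive (trans (ℤ.pos-+ (a ℕ.* b ℕ.+ b ℕ.* c₀) (c₀ ℕ.* a))
              (cong₂ _+_ (trans (ℤ.pos-+ (a ℕ.* b) (b ℕ.* c₀)) (cong₂ _+_ (ℤ.pos-* a b) (ℤ.pos-* b c₀))) (ℤ.pos-* c₀ a))))
              (+-cong-mod (+-cong-mod (≡-mod-refl (+ a * + b)) (*-cong-mod (≡-mod-refl (+ b)) c₀≡third))
                          (*-cong-mod c₀≡third (≡-mod-refl (+ a))))
      c₀-coprime⇔ : ((gcd (a ℕ.* b ℕ.* c₀) n ≡ 1) × (gcd (a ℕ.* b ℕ.+ b ℕ.* c₀ ℕ.+ c₀ ℕ.* a) n ≡ 1))
                    ⇔ Admissible n (+ a) (+ b)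
      c₀-coprime⇔ = ⇔-trans (gcd≡1⇔noCommonPrime n _ ×-⇔ gcd≡1⇔noCommonPrime n _)
                            (noCommonPrime-≡mod⇔ e₃≡ ×-⇔ noCommonPrime-≡mod⇔ e₂≡)

  g₃≡G : ∀ n .{{_ : NonZero n}} → g₃ m n ≡ G n
  g₃≡G n = begin
    length (filter (good? m n) (concatMap (λ a → concatMap (λ b → map (λ c → (a , b , c)) (upTo n)) (upTo n)) (upTo n)))
      ≡⟨ count-concatMap _ id n ⟩
    ∑[ a < n ] length (filter (good? m n) (concatMap (λ b → map (λ c → (a , b , c)) (upTo n)) (upTo n)))
      ≡⟨ ∑-cong-≗ n (λ a → count-concatMap _ id n) ⟩
    ∑[ a < n ] ∑[ b < n ] length (filter (good? m n) (map (λ c → (a , b , c)) (upTo n)))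
      ≡⟨ ∑-cong-≗ n (λ a → ∑-cong-≗ n (λ b → count-map _ id n)) ⟩
    ∑[ a < n ] ∑[ b < n ] ∑[ c < n ] 𝟙 (good? m n (a , b , c))
      ≡⟨ ∑-cong-≗ n (λ a → ∑-cong-≗ n (∑-good≡Φ n a)) ⟩
    G n  ∎
    where open ListCounting (good? m n)

module Orbits where
  open import Data.Empty using (⊥-elim)
  open import Data.Nat
  open import Data.Nat.Divisibility using (_∣_; divides)
  open import Data.Nat.Properties
  open import Data.Product using (_×_; _,_)
  open import Function using (_∘_; _⇔_; mk⇔)
  open import Relation.Binary.Definitions using (tri<; tri≈; tri>)
  open import Relation.Binary.PropositionalEquality
  open import Relation.Nullary using (Dec; yes; no; ¬_)
  open import Relation.Nullary.Decidable using (_×-dec_)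
  open Sums
  open ≡-Reasoning

  module _ {u v w : ℕ} (d₁ : Dec (u < v × u < w)) (d₂ : Dec (v < w × v < u)) (d₃ : Dec (w < u × w < v)) where

    private
      min₁ : u < v → u < w → 𝟙 d₁ + 𝟙 d₂ + 𝟙 d₃ ≡ 1
      min₁ u<v u<w = cong₂ _+_ (cong₂ _+_ (𝟙-yes (u<v , u<w) d₁) (𝟙-no (λ (_ , v<u) → <-asym v<u u<v) d₂))
                               (𝟙-no (λ (w<u , _) → <-asym w<u u<w) d₃)
      min₂ : v < w → v < u → 𝟙 d₁ + 𝟙 d₂ + 𝟙 d₃ ≡ 1
      min₂ v<w v<u = cong₂ _+_ (cong₂ _+_ (𝟙-no (λ (u<v , _) → <-asym u<v v<u) d₁) (𝟙-yes (v<w , v<u) d₂))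
                               (𝟙-no (λ (_ , w<v) → <-asym w<v v<w) d₃)
      min₃ : w < u → w < v → 𝟙 d₁ + 𝟙 d₂ + 𝟙 d₃ ≡ 1
      min₃ w<u w<v = cong₂ _+_ (cong₂ _+_ (𝟙-no (λ (_ , u<w) → <-asym u<w w<u) d₁) (𝟙-no (λ (v<w , _) → <-asym v<w w<v) d₂))
                               (𝟙-yes (w<u , w<v) d₃)

    exactly-one-minimum : u ≢ v → v ≢ w → w ≢ u → 𝟙 d₁ + 𝟙 d₂ + 𝟙 d₃ ≡ 1
    exactly-one-minimum u≢v v≢w w≢u with <-cmp u v | <-cmp v w | <-cmp w u
    ... | tri< u<v _ _ | _              | tri> _ _ u<w   = min₁ u<v u<w
    ... | tri> _ _ v<u | tri< v<w _ _   | _              = min₂ v<w v<u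
    ... | _            | tri> _ _ w<v   | tri< w<u _ _   = min₃ w<u w<v
    ... | tri< u<v _ _ | tri< v<w _ _   | tri< w<u _ _   = ⊥-elim (<-asym (<-trans u<v v<w) w<u)
    ... | tri> _ _ v<u | tri> _ _ w<v   | tri> _ _ u<w   = ⊥-elim (<-asym (<-trans w<v v<u) u<w)
    ... | tri≈ _ u≡v _ | _              | _              = ⊥-elim (u≢v u≡v)
    ... | _            | tri≈ _ v≡w _   | _              = ⊥-elim (v≢w v≡w)
    ... | _            | _              | tri≈ _ w≡u _   = ⊥-elim (w≢u w≡u)

  module _ n (τ : ℕ → ℕ) {S : ℕ → Set} (S? : ∀ x → Dec (S x))
           (τ< : ∀ x → x < n → τ x < n) (τ³≡id : ∀ x → x < n → τ (τ (τ x)) ≡ x)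
           (τ-preserves : ∀ x → x < n → S x → S (τ x)) (no-fixed-point : ∀ x → x < n → S x → τ x ≢ x) where

    private
      OrbitMinimum : ℕ → Set
      OrbitMinimum x = x < τ x × x < τ (τ x)

      orbitMinimum? : ∀ x → Dec (OrbitMinimum x)
      orbitMinimum? x = (x <? τ x) ×-dec (x <? τ (τ x))

      s : ℕ → ℕ
      s x = 𝟙 (S? x)

      g : ℕ → ℕ
      g x = s x * 𝟙 (orbitMinimum? x)

      τ-injective : ∀ x z → x < n → z < n → τ x ≡ τ z → x ≡ z
      τ-injective x z x<n z<n τx≡τz = trans (sym (τ³≡id x x<n)) (trans (cong (τ ∘ τ) τx≡τz) (τ³≡id z z<n))

      τ²-injective : ∀ x z → x < n → z < n → τ (τ x) ≡ τ (τ z) → x ≡ z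
      τ²-injective x z x<n z<n eq = τ-injective x z x<n z<n (τ-injective (τ x) (τ z) (τ< x x<n) (τ< z z<n) eq)

      τ-reflects : ∀ x → x < n → S (τ x) → S x
      τ-reflects x x<n Sτx = subst S (τ³≡id x x<n) (τ-preserves (τ (τ x)) (τ< _ (τ< x x<n)) (τ-preserves (τ x) (τ< x x<n) Sτx))

      g-¬S : ∀ {y} → ¬ S y → g y ≡ 0
      g-¬S {y} ¬Sy = cong (_* 𝟙 (orbitMinimum? y)) (𝟙-no ¬Sy (S? y))

      g-S : ∀ {y} → S y → g y ≡ 𝟙 (orbitMinimum? y)
      g-S {y} Sy = trans (cong (_* 𝟙 (orbitMinimum? y)) (𝟙-yes Sy (S? y))) (*-identityˡ _)

      s-orbit : ∀ x → x < n → Dec (S x) → s x ≡ g x + g (τ x) + g (τ (τ x))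
      s-orbit x x<n (no ¬Sx) = trans (𝟙-no ¬Sx (S? x)) (sym (begin
        g x + g v + g w  ≡⟨ cong₂ _+_ (cong₂ _+_ (g-¬S ¬Sx) (g-¬S (¬Sx ∘ τ-reflects x x<n)))
                                      (g-¬S (¬Sx ∘ τ-reflects x x<n ∘ τ-reflects v (τ< x x<n))) ⟩
        0                ∎))
        where
          v = τ x
          w = τ (τ x)
      s-orbit x x<n (yes Sx) = trans (𝟙-yes Sx (S? x)) (sym (begin
        g x + g v + g w
          ≡⟨ cong₂ _+_ (cong₂ _+_ (g-S Sx) (g-S Sv)) (g-S Sw) ⟩
        𝟙 (orbitMinimum? x) + 𝟙 (orbitMinimum? v) + 𝟙 (orbitMinimum? w)
          ≡⟨ cong₂ _+_ (cong (𝟙 (orbitMinimum? x) +_) (𝟙-cong rotate₁ (orbitMinimum? v) ((v <? w) ×-dec (v <? x))))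
                       (𝟙-cong rotate₂ (orbitMinimum? w) ((w <? x) ×-dec (w <? v))) ⟩
        𝟙 (orbitMinimum? x) + 𝟙 ((v <? w) ×-dec (v <? x)) + 𝟙 ((w <? x) ×-dec (w <? v))
          ≡⟨ exactly-one-minimum (orbitMinimum? x) ((v <? w) ×-dec (v <? x)) ((w <? x) ×-dec (w <? v))
                                 (no-fixed-point x x<n Sx ∘ sym) (no-fixed-point v (τ< x x<n) Sv ∘ sym)
                                 (λ w≡x → no-fixed-point x x<n Sx (trans (cong τ (sym w≡x)) τw≡x)) ⟩
        1 ∎))
        where
          v = τ x
          w = τ (τ x)
          τw≡x : τ w ≡ x
          τw≡x = τ³≡id x x<n
          Sv = τ-preserves x x<n Sx
          Sw = τ-preserves v (τ< x x<n) Sv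
          rotate₁ : OrbitMinimum v ⇔ (v < w × v < x)
          rotate₁ = mk⇔ (λ (v<w , v<τw) → v<w , subst (v <_) τw≡x v<τw)
                        (λ (v<w , v<x) → v<w , subst (v <_) (sym τw≡x) v<x)
          rotate₂ : OrbitMinimum w ⇔ (w < x × w < v)
          rotate₂ = mk⇔ (λ (w<τw , w<ττw) → subst (w <_) τw≡x w<τw , subst (w <_) (cong τ τw≡x) w<ττw)
                        (λ (w<x , w<v) → subst (w <_) (sym τw≡x) w<x , subst (w <_) (cong τ (sym τw≡x)) w<v)

    3∣∑ : 3 ∣ ∑[ x < n ] 𝟙 (S? x)
    3∣∑ = divides (∑< n g) (begin
      ∑< n s
        ≡⟨ ∑-cong n (λ x x<n → s-orbit x x<n (S? x)) ⟩
      ∑[ x < n ] (g x + g (τ x) + g (τ (τ x)))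
        ≡⟨ trans (∑-distrib-+ n _ _) (cong (_+ ∑[ x < n ] g (τ (τ x))) (∑-distrib-+ n _ _)) ⟩
      ∑< n g + ∑[ x < n ] g (τ x) + ∑[ x < n ] g (τ (τ x))
        ≡⟨ cong₂ _+_ (cong (∑< n g +_) (∑-reindex n τ τ< τ-injective g))
           (∑-reindex n (τ ∘ τ) (λ x x<n → τ< _ (τ< x x<n)) τ²-injective g) ⟩
      ∑< n g + ∑< n g + ∑< n g
        ≡⟨ solve 1 (λ k → k :+ k :+ k := k :* con 3) refl (∑< n g) ⟩
      ∑< n g * 3 ∎)
      where open import Data.Nat.Solver using (module +-*-Solver)
            open +-*-Solver

module LocalCount (m : ℕ) {p′ : ℕ} (p-prime : Prime (suc p′)) (p∤m : ¬ suc p′ ∣ m) where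
  open import Data.Empty using (⊥; ⊥-elim)
  open import Data.Integer hiding (NonZero; suc; pred; _≤_; _<_; _≟_)
  open import Data.Integer.Divisibility.Signed
    using (∣⇒∣ᵤ; ∣ᵤ⇒∣; divides; ∣m⇒∣-m; ∣m+n∣n⇒∣m; ∣m∣n⇒∣m-n; ∣m∣n⇒∣m+n; ∣m+n∣m⇒∣n; ∣m⇒∣m*n; ∣n⇒∣m*n)
  open import Data.Integer.Tactic.RingSolver using (solve-∀)
  open import Data.Nat as ℕ using (ℕ)
  import Data.Nat.Properties as ℕ
  import Data.Integer.Properties as ℤ
  open import Data.Nat.Divisibility using (∣⇒≤; ∣1⇒≡1; n∣m*n; m%n≡0⇒n∣m; quotient; m∣n⇒n≡quotient*m)
  import Data.Nat.DivMod as ℕ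
  open import Data.Nat.Primality using (prime?)
  open import Relation.Nullary.Decidable using (from-yes)
  open import Data.Product using (_×_; _,_)
  open import Data.Sum using (_⊎_; inj₁; inj₂; [_,_]′)
  open import Data.Integer.DivMod using (_%ℕ_; n%ℕd<d)
  open import Data.Product.Function.NonDependent.Propositional using (_×-⇔_)
  open import Function using (_⇔_; mk⇔; _∘_; id; Equivalence)
  open import Function.Properties.Equivalence using () renaming (sym to ⇔-sym)
  open import Relation.Binary.PropositionalEquality
  open import Relation.Nullary using (Dec; yes; no; ¬_)
  open import Relation.Nullary.Decidable using (_×-dec_; _⊎-dec_; ¬?)
  open Sums
  open Orbits
  open Congruence
  open PrimeDivisors
  open ResidueSums
  open PairCount m
  open Defs using (h)
  open ≡-Reasoning

  p : ℕ
  p = suc p′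

  ∑² : (ℕ → ℕ → ℕ) → ℕ
  ∑² f = ∑[ a < p ] ∑[ b < p ] f a b

  ∑²-cong : ∀ {f g : ℕ → ℕ → ℕ} → (∀ a b → f a b ≡ g a b) → ∑² f ≡ ∑² g
  ∑²-cong f≡g = ∑-cong-≗ p (λ a → ∑-cong-≗ p (f≡g a))

  ∑²-distrib-+ : ∀ f g → ∑² (λ a b → f a b ℕ.+ g a b) ≡ ∑² f ℕ.+ ∑² g
  ∑²-distrib-+ f g = trans (∑-cong-≗ p (λ a → ∑-distrib-+ p (f a) (g a)))
                           (∑-distrib-+ p (λ a → ∑< p (f a)) (λ a → ∑< p (g a)))

  ∑²-distrib-+₃ : ∀ f g h → ∑² (λ a b → f a b ℕ.+ g a b ℕ.+ h a b) ≡ ∑² f ℕ.+ ∑² g ℕ.+ ∑² h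
  ∑²-distrib-+₃ f g h = trans (∑²-distrib-+ (λ a b → f a b ℕ.+ g a b) h) (cong (ℕ._+ ∑² h) (∑²-distrib-+ f g))

  p∣? : ∀ a → Dec (p ∣ᶻ + a)
  p∣? a = p ∣ᶻ? + a

  p∣third? : ∀ a b → Dec (p ∣ᶻ third (+ a) (+ b))
  p∣third? a b = p ∣ᶻ? third (+ a) (+ b)

  e₃? : ∀ a b → Dec (p ∣ᶻ e₃ (+ a) (+ b))
  e₃? a b = p ∣ᶻ? e₃ (+ a) (+ b)

  e₂? : ∀ a b → Dec (p ∣ᶻ e₂ (+ a) (+ b))
  e₂? a b = p ∣ᶻ? e₂ (+ a) (+ b)

  p∤ᶻm : ¬ p ∣ᶻ + m
  p∤ᶻm = p∤m ∘ ∣⇒∣ᵤ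

  module _ (a b : ℕ) where

    private
      A B C : Set
      A = p ∣ᶻ + a
      B = p ∣ᶻ + b
      C = p ∣ᶻ third (+ a) (+ b)

      sum-is-m : ∀ a b m → m ≡ a + b + (m - a - b)
      sum-is-m = solve-∀

      e₂-viaᵃ : ∀ a b m → a * b + b * (m - a - b) + (m - a - b) * a ≡ a * (b + (m - a - b)) + b * (m - a - b)
      e₂-viaᵃ = solve-∀
      e₂-viaᵇ : ∀ a b m → a * b + b * (m - a - b) + (m - a - b) * a ≡ b * (a + (m - a - b)) + a * (m - a - b)
      e₂-viaᵇ = solve-∀
      e₂-viaᶜ : ∀ a b m → a * b + b * (m - a - b) + (m - a - b) * a ≡ (m - a - b) * (a + b) + a * b
      e₂-viaᶜ = solve-∀

      module Split {u s v w : ℤ} (e₂≡ : e₂ (+ a) (+ b) ≡ u * s + v * w) (p∣u : p ∣ᶻ u) where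
        ⇒ : p ∣ᶻ e₂ (+ a) (+ b) → p ∣ᶻ v ⊎ p ∣ᶻ w
        ⇒ p∣e₂ = euclidsLemmaᶻ v w p-prime (∣m+n∣m⇒∣n (subst (p ∣ᶻ_) e₂≡ p∣e₂) (∣m⇒∣m*n s p∣u))
        ⇐ : p ∣ᶻ v ⊎ p ∣ᶻ w → p ∣ᶻ e₂ (+ a) (+ b)
        ⇐ p∣v⊎w = subst (p ∣ᶻ_) (sym e₂≡) (∣m∣n⇒∣m+n (∣m⇒∣m*n s p∣u) ([ ∣m⇒∣m*n w , ∣n⇒∣m*n v ]′ p∣v⊎w))

      module Splitᵃ = Split {+ a} {+ b + third (+ a) (+ b)} {+ b} {third (+ a) (+ b)} (e₂-viaᵃ (+ a) (+ b) (+ m))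
      module Splitᵇ = Split {+ b} {+ a + third (+ a) (+ b)} {+ a} {third (+ a) (+ b)} (e₂-viaᵇ (+ a) (+ b) (+ m))
      module Splitᶜ = Split {third (+ a) (+ b)} {+ a + + b} {+ a} {+ b} (e₂-viaᶜ (+ a) (+ b) (+ m))

    ¬all-three : A → B → C → ⊥
    ¬all-three p∣a p∣b p∣c =
      p∤ᶻm (subst (p ∣ᶻ_) (sym (sum-is-m (+ a) (+ b) (+ m))) (∣m∣n⇒∣m+n (∣m∣n⇒∣m+n p∣a p∣b) p∣c))

    e₃-zero⇔ : p ∣ᶻ e₃ (+ a) (+ b) ⇔ (A ⊎ B ⊎ C)
    e₃-zero⇔ = mk⇔
      (λ p∣e₃ → [ (λ p∣ab → [ inj₁ , inj₂ ∘ inj₁ ]′ (euclidsLemmaᶻ (+ a) (+ b) p-prime p∣ab)) , inj₂ ∘ inj₂ ]′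
                 (euclidsLemmaᶻ (+ a * + b) (third (+ a) (+ b)) p-prime p∣e₃))
      [ ∣m⇒∣m*n _ ∘ ∣m⇒∣m*n (+ b) , [ ∣m⇒∣m*n _ ∘ ∣n⇒∣m*n (+ a) , ∣n⇒∣m*n (+ a * + b) ]′ ]′

    -- Once one of a, b, c vanishes mod p, e₂ reduces to the product of the other two.
    e₃e₂-zero⇔ : (p ∣ᶻ e₃ (+ a) (+ b) × p ∣ᶻ e₂ (+ a) (+ b)) ⇔ ((A × B) ⊎ (A × C) ⊎ (B × C))
    e₃e₂-zero⇔ = mk⇔ ⇒ ⇐
      where
        ⇒ : p ∣ᶻ e₃ (+ a) (+ b) × p ∣ᶻ e₂ (+ a) (+ b) → (A × B) ⊎ (A × C) ⊎ (B × C)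
        ⇒ (p∣e₃ , p∣e₂) with Equivalence.to e₃-zero⇔ p∣e₃
        ... | inj₁ p∣a        = [ (λ p∣b → inj₁ (p∣a , p∣b)) , (λ p∣c → inj₂ (inj₁ (p∣a , p∣c))) ]′
                                  (Splitᵃ.⇒ p∣a p∣e₂)
        ... | inj₂ (inj₁ p∣b) = [ (λ p∣a → inj₁ (p∣a , p∣b)) , (λ p∣c → inj₂ (inj₂ (p∣b , p∣c))) ]′
                                  (Splitᵇ.⇒ p∣b p∣e₂)
        ... | inj₂ (inj₂ p∣c) = [ (λ p∣a → inj₂ (inj₁ (p∣a , p∣c))) , (λ p∣b → inj₂ (inj₂ (p∣b , p∣c))) ]′
                                  (Splitᶜ.⇒ p∣c p∣e₂)
        ⇐ : (A × B) ⊎ (A × C) ⊎ (B × C) → p ∣ᶻ e₃ (+ a) (+ b) × p ∣ᶻ e₂ (+ a) (+ b)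
        ⇐ (inj₁ (p∣a , p∣b))        = Equivalence.from e₃-zero⇔ (inj₁ p∣a) , Splitᵃ.⇐ p∣a (inj₁ p∣b)
        ⇐ (inj₂ (inj₁ (p∣a , p∣c))) = Equivalence.from e₃-zero⇔ (inj₁ p∣a) , Splitᵃ.⇐ p∣a (inj₂ p∣c)
        ⇐ (inj₂ (inj₂ (p∣b , p∣c))) = Equivalence.from e₃-zero⇔ (inj₂ (inj₁ p∣b)) , Splitᵇ.⇐ p∣b (inj₂ p∣c)

  private
    third-swap : ∀ a b → third (+ a) (+ b) ≡ (+ m - + b) - + a
    third-swap a b = swap (+ a) (+ b) (+ m)
      where swap : ∀ a b m → m - a - b ≡ m - b - a
            swap = solve-∀

    𝟙A 𝟙B : ℕ → ℕ → ℕ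
    𝟙A a b = 𝟙 (p∣? a)
    𝟙B a b = 𝟙 (p∣? b)

    𝟙C : ℕ → ℕ → ℕ
    𝟙C a b = 𝟙 (p∣third? a b)

    ∑-C-column : ∀ b (f : ℕ → ℕ) → ∑[ a < p ] (𝟙C a b ℕ.* f a) ≡ f ((+ m - + b) %ℕ p)
    ∑-C-column b f = trans (∑-cong-≗ p (λ a → cong (λ X → 𝟙 (p ∣ᶻ? X) ℕ.* f a) (third-swap a b))) (∑-≡mod p (+ m - + b) f)

    ∑²-A : ∑² 𝟙A ≡ p
    ∑²-A = trans (∑-cong-≗ p (λ a → trans (∑-const p (𝟙 (p∣? a))) (ℕ.*-comm p (𝟙 (p∣? a))))) (∑-∣ p (λ _ → p))

    ∑²-B : ∑² 𝟙B ≡ p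
    ∑²-B = trans (∑-cong-≗ p (λ _ → ∑-∣-count p)) (∑-count p)

    ∑²-C : ∑² 𝟙C ≡ p
    ∑²-C = trans (∑-cong-≗ p (λ a → ∑-≡mod-count p (+ m - + a))) (∑-count p)

    ∑²-AB : ∑² (λ a b → 𝟙A a b ℕ.* 𝟙B a b) ≡ 1
    ∑²-AB = trans (∑-cong-≗ p (λ a → trans (sym (*-distribˡ-∑ p (𝟙 (p∣? a)) (λ b → 𝟙 (p∣? b))))
                                           (cong (𝟙 (p∣? a) ℕ.*_) (∑-∣-count p))))
                  (∑-∣ p (λ _ → 1))

    ∑²-AC : ∑² (λ a b → 𝟙A a b ℕ.* 𝟙C a b) ≡ 1
    ∑²-AC = trans (∑-cong-≗ p (λ a → trans (sym (*-distribˡ-∑ p (𝟙 (p∣? a)) (𝟙C a)))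
                                           (cong (𝟙 (p∣? a) ℕ.*_) (∑-≡mod-count p (+ m - + a)))))
                  (∑-∣ p (λ _ → 1))

    ∑²-BC : ∑² (λ a b → 𝟙B a b ℕ.* 𝟙C a b) ≡ 1
    ∑²-BC = begin
      ∑[ a < p ] ∑[ b < p ] (𝟙 (p∣? b) ℕ.* 𝟙C a b)
        ≡⟨ ∑-comm p p (λ a b → 𝟙 (p∣? b) ℕ.* 𝟙C a b) ⟩
      ∑[ b < p ] ∑[ a < p ] (𝟙 (p∣? b) ℕ.* 𝟙C a b)
        ≡⟨ ∑-cong-≗ p (λ b → sym (*-distribˡ-∑ p (𝟙 (p∣? b)) (λ a → 𝟙C a b))) ⟩
      ∑[ b < p ] (𝟙 (p∣? b) ℕ.* ∑[ a < p ] 𝟙C a b)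
        ≡⟨ ∑-cong-≗ p (λ b → cong (𝟙 (p∣? b) ℕ.*_)
           (trans (∑-cong-≗ p (λ a → sym (ℕ.*-identityʳ (𝟙C a b)))) (∑-C-column b (λ _ → 1)))) ⟩
      ∑[ b < p ] (𝟙 (p∣? b) ℕ.* 1)
        ≡⟨ ∑-∣ p (λ _ → 1) ⟩
      1 ∎

    pairs : ℕ → ℕ → ℕ
    pairs a b = 𝟙A a b ℕ.* 𝟙B a b ℕ.+ 𝟙A a b ℕ.* 𝟙C a b ℕ.+ 𝟙B a b ℕ.* 𝟙C a b

    ∑²-pairs : ∑² pairs ≡ 3
    ∑²-pairs = trans (∑²-distrib-+₃ (λ a b → 𝟙A a b ℕ.* 𝟙B a b) (λ a b → 𝟙A a b ℕ.* 𝟙C a b) (λ a b → 𝟙B a b ℕ.* 𝟙C a b))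
                     (cong₂ ℕ._+_ (cong₂ ℕ._+_ ∑²-AB ∑²-AC) ∑²-BC)

  count-e₃ : ∑² (λ a b → 𝟙 (e₃? a b)) ℕ.+ 3 ≡ p ℕ.+ p ℕ.+ p
  count-e₃ = begin
    ∑² (λ a b → 𝟙 (e₃? a b)) ℕ.+ 3
      ≡⟨ cong (∑² (λ a b → 𝟙 (e₃? a b)) ℕ.+_) ∑²-pairs ⟨
    ∑² (λ a b → 𝟙 (e₃? a b)) ℕ.+ ∑² pairs
      ≡⟨ ∑²-distrib-+ (λ a b → 𝟙 (e₃? a b)) pairs ⟨
    ∑² (λ a b → 𝟙 (e₃? a b) ℕ.+ pairs a b)
      ≡⟨ ∑²-cong (λ a b → trans (cong (ℕ._+ pairs a b) (𝟙-cong (e₃-zero⇔ a b) (e₃? a b) (p∣? a ⊎-dec p∣? b ⊎-dec p∣third? a b)))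
         (𝟙-⊎₃ (¬all-three a b) (p∣? a) (p∣? b) (p∣third? a b))) ⟩
    ∑² (λ a b → 𝟙A a b ℕ.+ 𝟙B a b ℕ.+ 𝟙C a b)
      ≡⟨ ∑²-distrib-+₃ 𝟙A 𝟙B 𝟙C ⟩
    ∑² 𝟙A ℕ.+ ∑² 𝟙B ℕ.+ ∑² 𝟙C
      ≡⟨ cong₂ ℕ._+_ (cong₂ ℕ._+_ ∑²-A ∑²-B) ∑²-C ⟩
    p ℕ.+ p ℕ.+ p ∎

  count-e₃e₂ : ∑² (λ a b → 𝟙 (e₃? a b ×-dec e₂? a b)) ≡ 3
  count-e₃e₂ = trans (∑²-cong λ a b → trans
                       (𝟙-cong (e₃e₂-zero⇔ a b) (e₃? a b ×-dec e₂? a b)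
                               ((p∣? a ×-dec p∣? b) ⊎-dec (p∣? a ×-dec p∣third? a b) ⊎-dec (p∣? b ×-dec p∣third? a b)))
                       (𝟙-two-of-three (¬all-three a b) (p∣? a) (p∣? b) (p∣third? a b)))
                     ∑²-pairs

  Φ-prime : ∀ a b → Φ p a b ≡ 𝟙 (¬? (e₃? a b) ×-dec ¬? (e₂? a b))
  Φ-prime a b = Φ-char p a b (¬? (e₃? a b) ×-dec ¬? (e₂? a b))
    (⇔-sym (noCommonPrime-prime⇔ (e₃ (+ a) (+ b)) p-prime ×-⇔ noCommonPrime-prime⇔ (e₂ (+ a) (+ b)) p-prime))

  G-inclusion-exclusion : G p ℕ.+ ∑² (λ a b → 𝟙 (e₃? a b)) ℕ.+ ∑² (λ a b → 𝟙 (e₂? a b)) ≡ p ℕ.* p ℕ.+ 3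
  G-inclusion-exclusion = begin
    G p ℕ.+ ∑² 𝟙e₃ ℕ.+ ∑² 𝟙e₂
      ≡⟨ cong (λ X → X ℕ.+ ∑² 𝟙e₃ ℕ.+ ∑² 𝟙e₂) (∑²-cong Φ-prime) ⟩
    ∑² neither ℕ.+ ∑² 𝟙e₃ ℕ.+ ∑² 𝟙e₂
      ≡⟨ ∑²-distrib-+₃ neither 𝟙e₃ 𝟙e₂ ⟨
    ∑² (λ a b → neither a b ℕ.+ 𝟙e₃ a b ℕ.+ 𝟙e₂ a b)
      ≡⟨ ∑²-cong (λ a b → 𝟙-inclusion-exclusion (e₃? a b) (e₂? a b)) ⟩
    ∑² (λ a b → 1 ℕ.+ 𝟙 (e₃? a b ×-dec e₂? a b))
      ≡⟨ ∑²-distrib-+ (λ _ _ → 1) (λ a b → 𝟙 (e₃? a b ×-dec e₂? a b)) ⟩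
    ∑² (λ _ _ → 1) ℕ.+ ∑² (λ a b → 𝟙 (e₃? a b ×-dec e₂? a b))
      ≡⟨ cong₂ ℕ._+_ (trans (∑-cong-≗ p (λ _ → ∑-count p)) (∑-const p p)) count-e₃e₂ ⟩
    p ℕ.* p ℕ.+ 3 ∎
    where
      𝟙e₃ 𝟙e₂ neither : ℕ → ℕ → ℕ
      𝟙e₃ a b = 𝟙 (e₃? a b)
      𝟙e₂ a b = 𝟙 (e₂? a b)
      neither a b = 𝟙 (¬? (e₃? a b) ×-dec ¬? (e₂? a b))

  -- Zeros of e₂ with a ≢ 0 are parametrised by the slope t = b / a: on the line b = t a
  -- one has e₂ = a · E a t with E a t = m (1 + t) − a (1 + t + t²).
  α : ℕ → ℕ
  α t = 1 ℕ.+ t ℕ.+ t ℕ.* t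

  r : ℕ
  r = ∑[ t < p ] 𝟙 (p ∣ᶻ? + α t)

  E : ℕ → ℕ → ℤ
  E a t = + m * + suc t - + (a ℕ.* α t)

  private
    α-form : ∀ t → + α t ≡ 1ℤ + + t + + t * + t
    α-form t = trans (ℤ.pos-+ (1 ℕ.+ t) (t ℕ.* t)) (cong₂ _+_ (ℤ.pos-+ 1 t) (ℤ.pos-* t t))

    E-form : ∀ a t → E a t ≡ + m * (1ℤ + + t) - + a * (1ℤ + + t + + t * + t)
    E-form a t = cong₂ (λ β aα → + m * β - aα) (ℤ.pos-+ 1 t) (trans (ℤ.pos-* a (α t)) (cong (+ a *_) (α-form t)))

    p∤small : ∀ {k} → 0 ℕ.< k → k ℕ.< p → ¬ p ∣ᶻ + k
    p∤small 0<k k<p p∣k = ℕ.<⇒≱ k<p (∣⇒≤ {{ℕ.>-nonZero 0<k}} (∣⇒∣ᵤ p∣k))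

    p∣E∧p∣aα⇒p∣β : ∀ a t → p ∣ᶻ E a t → p ∣ᶻ + (a ℕ.* α t) → p ∣ᶻ + suc t
    p∣E∧p∣aα⇒p∣β a t p∣E p∣aα with euclidsLemmaᶻ (+ m) (+ suc t) p-prime (∣m+n∣n⇒∣m p∣E (∣m⇒∣-m p∣aα))
    ... | inj₁ p∣m  = ⊥-elim (p∤ᶻm p∣m)
    ... | inj₂ p∣β  = p∣β

  e₂-row-zero⇔ : ∀ b → p ∣ᶻ e₂ 0ℤ (+ b) ⇔ (p ∣ᶻ + b ⊎ p ∣ᶻ third 0ℤ (+ b))
  e₂-row-zero⇔ b = mk⇔
    (λ p∣e₂ → euclidsLemmaᶻ (+ b) (third 0ℤ (+ b)) p-prime (subst (p ∣ᶻ_) (row-form (+ b) (+ m)) p∣e₂))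
    (λ p∣b⊎c → subst (p ∣ᶻ_) (sym (row-form (+ b) (+ m))) ([ ∣m⇒∣m*n _ , ∣n⇒∣m*n (+ b) ]′ p∣b⊎c))
    where row-form : ∀ b m → 0ℤ * b + b * (m - 0ℤ - b) + (m - 0ℤ - b) * 0ℤ ≡ b * (m - 0ℤ - b)
          row-form = solve-∀

  row-zero : ∑[ b < p ] 𝟙 (e₂? 0 b) ≡ 2
  row-zero = begin
    ∑[ b < p ] 𝟙 (e₂? 0 b)
      ≡⟨ ∑-cong-≗ p (λ b → 𝟙-cong (e₂-row-zero⇔ b) (e₂? 0 b) (p∣? b ⊎-dec p∣third? 0 b)) ⟩
    ∑[ b < p ] 𝟙 (p∣? b ⊎-dec p∣third? 0 b)
      ≡⟨ ∑-cong-≗ p (λ b → 𝟙-⊎ (¬all-three 0 b (divides 0ℤ refl)) (p∣? b) (p∣third? 0 b)) ⟩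
    ∑[ b < p ] (𝟙 (p∣? b) ℕ.+ 𝟙 (p∣third? 0 b))
      ≡⟨ ∑-distrib-+ p (λ b → 𝟙 (p∣? b)) (λ b → 𝟙 (p∣third? 0 b)) ⟩
    ∑[ b < p ] 𝟙 (p∣? b) ℕ.+ ∑[ b < p ] 𝟙 (p∣third? 0 b)
      ≡⟨ cong₂ ℕ._+_ (∑-∣-count p) (∑-≡mod-count p (+ m - 0ℤ)) ⟩
    2 ∎

  e₂-on-line : ∀ a t → e₂ (+ a) (+ (t ℕ.* a ℕ.+ 0)) ≡ + a * E a t
  e₂-on-line a t = begin
    e₂ (+ a) (+ (t ℕ.* a ℕ.+ 0))
      ≡⟨ cong (e₂ (+ a))
         (trans (cong +_ (ℕ.+-identityʳ (t ℕ.* a))) (ℤ.pos-* t a)) ⟩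
    e₂ (+ a) (+ t * + a)
      ≡⟨ line (+ a) (+ t) (+ m) ⟩
    + a * (+ m * (1ℤ + + t) - + a * (1ℤ + + t + + t * + t))
      ≡⟨ cong (+ a *_) (E-form a t) ⟨
    + a * E a t ∎
    where line : ∀ x t m → x * (t * x) + (t * x) * (m - x - t * x) + (m - x - t * x) * x
                           ≡ x * (m * (1ℤ + t) - x * (1ℤ + t + t * t))
          line = solve-∀

  row : ∀ a → ¬ p ∣ᶻ + a → ∑[ b < p ] 𝟙 (e₂? a b) ≡ ∑[ t < p ] 𝟙 (p ∣ᶻ? E a t)
  row a p∤a = begin
    ∑[ b < p ] 𝟙 (e₂? a b)                   ≡⟨ ∑-affine p a 0 (prime∤⇒coprime p-prime (p∤a ∘ ∣ᵤ⇒∣))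
                                                           (λ b → 𝟙 (e₂? a b)) e₂-periodic ⟨
    ∑[ t < p ] 𝟙 (e₂? a (t ℕ.* a ℕ.+ 0))     ≡⟨ ∑-cong-≗ p (λ t → 𝟙-cong (on-line t) (e₂? a (t ℕ.* a ℕ.+ 0)) (p ∣ᶻ? E a t)) ⟩
    ∑[ t < p ] 𝟙 (p ∣ᶻ? E a t)               ∎
    where
      e₂-periodic : Periodic p (λ b → 𝟙 (e₂? a b))
      e₂-periodic b = 𝟙-cong (mk⇔ (∣ᶻ-resp-≡mod shift) (∣ᶻ-resp-≡mod (≡-mod-sym shift))) (e₂? a (b ℕ.+ p)) (e₂? a b)
        where shift = e₂-cong-mod (≡-mod-refl (+ a)) (+n≡-mod b)
      on-line : ∀ t → p ∣ᶻ e₂ (+ a) (+ (t ℕ.* a ℕ.+ 0)) ⇔ p ∣ᶻ E a t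
      on-line t = mk⇔
        (λ p∣e₂ → [ ⊥-elim ∘ p∤a , id ]′ (euclidsLemmaᶻ (+ a) (E a t) p-prime (subst (p ∣ᶻ_) (e₂-on-line a t) p∣e₂)))
        (λ p∣E → subst (p ∣ᶻ_) (sym (e₂-on-line a t)) (∣n⇒∣m*n (+ a) p∣E))

  E-zero⇔ : ∀ t → p ∣ᶻ E 0 t ⇔ p ∣ᶻ + suc t
  E-zero⇔ t = mk⇔
    (λ p∣E → p∣E∧p∣aα⇒p∣β 0 t p∣E (divides 0ℤ refl))
    (λ p∣β → subst (p ∣ᶻ_) (sym (ℤ.+-identityʳ _)) (∣n⇒∣m*n (+ m) p∣β))

  I : ℕ → ℕ
  I t = ∑[ a < p′ ] 𝟙 (p ∣ᶻ? E (suc a) t)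

  -- a ↦ E a t is affine with slope −α t: it has one root mod p when p ∤ α t, and none when
  -- p ∣ α t (then p ∤ 1 + t, since α t − t (1 + t) = 1); the root is a = 0 iff p ∣ 1 + t.
  I+α+β : ∀ t → (α? : Dec (p ∣ᶻ + α t)) → I t ℕ.+ 𝟙 α? ℕ.+ 𝟙 (p ∣ᶻ? + suc t) ≡ 1
  I+α+β t (yes p∣α) = cong₂ (λ i b → i ℕ.+ 1 ℕ.+ b) I≡0 (𝟙-no p∤β (p ∣ᶻ? + suc t))
    where
      p∤β : ¬ p ∣ᶻ + suc t
      p∤β p∣β = prime≢1 p-prime (∣1⇒≡1 (∣⇒∣ᵤ (subst (p ∣ᶻ_) α-tβ≡1 (∣m∣n⇒∣m-n p∣α (∣n⇒∣m*n (+ t) p∣β)))))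
        where
          unit : ∀ t → (1ℤ + t + t * t) - t * (1ℤ + t) ≡ 1ℤ
          unit = solve-∀
          α-tβ≡1 : + α t - + t * + suc t ≡ 1ℤ
          α-tβ≡1 = trans (cong₂ (λ a b → a - + t * b) (α-form t) (ℤ.pos-+ 1 t)) (unit (+ t))
      I≡0 : I t ≡ 0
      I≡0 = ∑-zero p′ (λ a _ → 𝟙-no (λ p∣E → p∤β (p∣E∧p∣aα⇒p∣β (suc a) t p∣E
                                   (subst (p ∣ᶻ_) (sym (ℤ.pos-* (suc a) (α t))) (∣n⇒∣m*n (+ suc a) p∣α))))
                                 (p ∣ᶻ? E (suc a) t))
  I+α+β t (no p∤α) = begin
    I t ℕ.+ 0 ℕ.+ 𝟙 (p ∣ᶻ? + suc t)
      ≡⟨ trans (cong (ℕ._+ 𝟙 (p ∣ᶻ? + suc t)) (ℕ.+-identityʳ (I t)))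
         (ℕ.+-comm (I t) (𝟙 (p ∣ᶻ? + suc t))) ⟩
    𝟙 (p ∣ᶻ? + suc t) ℕ.+ I t
      ≡⟨ cong (ℕ._+ I t) (𝟙-cong (⇔-sym (E-zero⇔ t)) (p ∣ᶻ? + suc t) (p ∣ᶻ? E 0 t)) ⟩
    ∑[ a < p ] 𝟙 (p ∣ᶻ? E a t)
      ≡⟨ ∑-cong-≗ p (λ a → cong (λ x → 𝟙 (p ∣ᶻ? (K - + x))) (sym (ℕ.+-identityʳ (a ℕ.* α t)))) ⟩
    ∑[ a < p ] 𝟙 (p ∣ᶻ? (K - + (a ℕ.* α t ℕ.+ 0)))
      ≡⟨ ∑-affine p (α t) 0 (prime∤⇒coprime p-prime (p∤α ∘ ∣ᵤ⇒∣))
         (λ x → 𝟙 (p ∣ᶻ? (K - + x))) (residue-periodic p K) ⟩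
    ∑[ x < p ] 𝟙 (p ∣ᶻ? (K - + x))
      ≡⟨ ∑-≡mod-count p K ⟩
    1 ∎
    where K = + m * + suc t

  ∑-β : ∑[ t < p ] 𝟙 (p ∣ᶻ? + suc t) ≡ 1
  ∑-β = ∑-unique-count p p′ (λ t → p ∣ᶻ? + suc t) (ℕ.n<1+n p′) (n∣ᶻn p)
    (λ t t<p p∣β → ℕ.suc-injective (ℕ.≤-antisym t<p (∣⇒≤ (∣⇒∣ᵤ p∣β))))

  ∑I+r : ∑< p I ℕ.+ r ℕ.+ 1 ≡ p
  ∑I+r = begin
    ∑< p I ℕ.+ r ℕ.+ 1
      ≡⟨ cong (∑< p I ℕ.+ r ℕ.+_) ∑-β ⟨
    ∑< p I ℕ.+ r ℕ.+ ∑[ t < p ] 𝟙 (p ∣ᶻ? + suc t)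
      ≡⟨ trans (∑-distrib-+ p (λ t → I t ℕ.+ 𝟙 (p ∣ᶻ? + α t)) (λ t → 𝟙 (p ∣ᶻ? + suc t)))
         (cong (ℕ._+ ∑[ t < p ] 𝟙 (p ∣ᶻ? + suc t)) (∑-distrib-+ p I (λ t → 𝟙 (p ∣ᶻ? + α t)))) ⟨
    ∑[ t < p ] (I t ℕ.+ 𝟙 (p ∣ᶻ? + α t) ℕ.+ 𝟙 (p ∣ᶻ? + suc t))
      ≡⟨ ∑-cong-≗ p (λ t → I+α+β t (p ∣ᶻ? + α t)) ⟩
    ∑[ t < p ] 1
      ≡⟨ ∑-count p ⟩
    p ∎

  count-e₂+r : ∑² (λ a b → 𝟙 (e₂? a b)) ℕ.+ r ≡ suc p
  count-e₂+r = begin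
    (∑[ b < p ] 𝟙 (e₂? 0 b) ℕ.+ ∑[ a < p′ ] ∑[ b < p ] 𝟙 (e₂? (suc a) b)) ℕ.+ r
      ≡⟨ cong (ℕ._+ r) (cong₂ ℕ._+_ row-zero (∑-cong p′ (λ a a<p′ → row (suc a) (p∤small ℕ.z<s (ℕ.s<s a<p′))))) ⟩
    2 ℕ.+ ∑[ a < p′ ] ∑[ t < p ] 𝟙 (p ∣ᶻ? E (suc a) t) ℕ.+ r
      ≡⟨ cong (λ x → 2 ℕ.+ x ℕ.+ r) (∑-comm p′ p (λ a t → 𝟙 (p ∣ᶻ? E (suc a) t))) ⟩
    2 ℕ.+ ∑< p I ℕ.+ r
      ≡⟨ cong (suc ∘ suc) (ℕ.suc-injective (trans (ℕ.+-comm 1 (∑< p I ℕ.+ r)) ∑I+r)) ⟩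
    suc p
      ∎

  private
    /-encode : ∀ k i → i ℕ.< p → (k ℕ.* p ℕ.+ i) ℕ./ p ≡ k
    /-encode k i i<p = trans (ℕ.+-distrib-/-∣ˡ i (n∣m*n k))
                             (trans (cong₂ ℕ._+_ (ℕ.m*n/n≡m k p) (ℕ.m<n⇒m/n≡0 i<p)) (ℕ.+-identityʳ k))

    %-encode : ∀ k i → i ℕ.< p → (k ℕ.* p ℕ.+ i) ℕ.% p ≡ i
    %-encode k i i<p = trans (cong (ℕ._% p) (ℕ.+-comm (k ℕ.* p) i)) (trans (ℕ.[m+kn]%n≡m%n i k p) (ℕ.m<n⇒m%n≡m i<p))

    encode-decode : ∀ x → x ℕ./ p ℕ.* p ℕ.+ x ℕ.% p ≡ x
    encode-decode x = trans (ℕ.+-comm _ (x ℕ.% p)) (sym (ℕ.m≡m%n+[m/n]*n x p))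

    encode-< : ∀ k i → k ℕ.< p → i ℕ.< p → k ℕ.* p ℕ.+ i ℕ.< p ℕ.* p
    encode-< k i k<p i<p = ℕ.<-≤-trans (ℕ.+-monoʳ-< (k ℕ.* p) i<p)
                                       (subst (ℕ._≤ p ℕ.* p) (ℕ.+-comm p (k ℕ.* p)) (ℕ.*-monoˡ-≤ p k<p))

    prime[3] : Prime 3
    prime[3] = from-yes (prime? 3)

  ∑²-encode : ∀ f → ∑[ x < p ℕ.* p ] f (x ℕ./ p) (x ℕ.% p) ≡ ∑² f
  ∑²-encode f = trans (∑-blocks p p (λ x → f (x ℕ./ p) (x ℕ.% p)))
                      (∑-cong p (λ k _ → ∑-cong p (λ i i<p → cong₂ f (/-encode k i i<p) (%-encode k i i<p))))

  -- The rotation (a, b, c) ↦ (b, c, a), acting on pairs encoded as a p + b, permutes the zeros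
  -- of e₂ without fixed points: a fixed point has a ≡ b ≡ c, hence 3 a ≡ m and e₂ ≡ 3 a².
  module _ (p≢3 : p ≢ 3) where

    private
      c : ℕ → ℕ → ℕ
      c a b = third (+ a) (+ b) %ℕ p

      c≡third : ∀ a b → + c a b ≡ third (+ a) (+ b) [mod p ]
      c≡third a b = %ℕ-≡mod p (third (+ a) (+ b))

      third-involutionˡ : ∀ m a b → m - b - (m - a - b) ≡ a
      third-involutionˡ = solve-∀

      third-involutionʳ : ∀ m a b → m - (m - a - b) - a ≡ b
      third-involutionʳ = solve-∀

      e₂-rotate : ∀ m a b → b * (m - a - b) + (m - a - b) * (m - b - (m - a - b)) + (m - b - (m - a - b)) * b
                            ≡ a * b + b * (m - a - b) + (m - a - b) * a
      e₂-rotate = solve-∀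

      c-rotate₁ : ∀ a b → a ℕ.< p → c b (c a b) ≡ a
      c-rotate₁ a b a<p = %ℕ-unique p (≡-mod-trans (third-cong-mod (≡-mod-refl (+ b)) (c≡third a b))
                                                   (≡-mod-reflexive (third-involutionˡ (+ m) (+ a) (+ b)))) a<p

      c-rotate₂ : ∀ a b → b ℕ.< p → c (c a b) a ≡ b
      c-rotate₂ a b b<p = %ℕ-unique p (≡-mod-trans (third-cong-mod (c≡third a b) (≡-mod-refl (+ a)))
                                                   (≡-mod-reflexive (third-involutionʳ (+ m) (+ a) (+ b)))) b<p

      τ : ℕ → ℕ
      τ x = x ℕ.% p ℕ.* p ℕ.+ c (x ℕ./ p) (x ℕ.% p)

      τ/ : ∀ x → τ x ℕ./ p ≡ x ℕ.% p
      τ/ x = /-encode (x ℕ.% p) (c (x ℕ./ p) (x ℕ.% p)) (n%ℕd<d (third (+ (x ℕ./ p)) (+ (x ℕ.% p))) p)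

      τ% : ∀ x → τ x ℕ.% p ≡ c (x ℕ./ p) (x ℕ.% p)
      τ% x = %-encode (x ℕ.% p) (c (x ℕ./ p) (x ℕ.% p)) (n%ℕd<d (third (+ (x ℕ./ p)) (+ (x ℕ.% p))) p)

      τ< : ∀ x → x ℕ.< p ℕ.* p → τ x ℕ.< p ℕ.* p
      τ< x _ = encode-< (x ℕ.% p) (c (x ℕ./ p) (x ℕ.% p)) (ℕ.m%n<n x p) (n%ℕd<d (third (+ (x ℕ./ p)) (+ (x ℕ.% p))) p)

      τ³≡id : ∀ x → x ℕ.< p ℕ.* p → τ (τ (τ x)) ≡ x
      τ³≡id x x<pp = begin
        τ (τ (τ x))                            ≡⟨ cong τ (cong₂ (λ u v → u ℕ.* p ℕ.+ c (τ x ℕ./ p) v) (τ% x) (τ% x)) ⟩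
        τ (c₁ ℕ.* p ℕ.+ c (τ x ℕ./ p) c₁)      ≡⟨ cong (λ z → τ (c₁ ℕ.* p ℕ.+ c z c₁)) (τ/ x) ⟩
        τ (c₁ ℕ.* p ℕ.+ c b c₁)                ≡⟨ cong (λ z → τ (c₁ ℕ.* p ℕ.+ z)) (c-rotate₁ a b a<p) ⟩
        τ (c₁ ℕ.* p ℕ.+ a)                     ≡⟨ cong₂ (λ u v → u ℕ.* p ℕ.+ c v u) (%-encode c₁ a a<p) (/-encode c₁ a a<p) ⟩
        a ℕ.* p ℕ.+ c c₁ a                     ≡⟨ cong (a ℕ.* p ℕ.+_) (c-rotate₂ a b (ℕ.m%n<n x p)) ⟩
        a ℕ.* p ℕ.+ b                          ≡⟨ encode-decode x ⟩
        x                                      ∎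
        where
          a = x ℕ./ p
          b = x ℕ.% p
          c₁ = c a b
          a<p = ℕ.m<n*o⇒m/o<n x<pp

      S : ℕ → Set
      S x = p ∣ᶻ e₂ (+ (x ℕ./ p)) (+ (x ℕ.% p))

      τ-preserves : ∀ x → x ℕ.< p ℕ.* p → S x → S (τ x)
      τ-preserves x _ Sx = subst₂ (λ u v → p ∣ᶻ e₂ (+ u) (+ v)) (sym (τ/ x)) (sym (τ% x))
        (∣ᶻ-resp-≡mod (e₂-cong-mod (≡-mod-refl (+ b)) (≡-mod-sym (c≡third a b)))
                      (subst (p ∣ᶻ_) (sym (e₂-rotate (+ m) (+ a) (+ b))) Sx))
        where
          a = x ℕ./ p
          b = x ℕ.% p

      no-fixed-point : ∀ x → x ℕ.< p ℕ.* p → S x → τ x ≢ x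
      no-fixed-point x _ Sx τx≡x =
        [ p∤3 , [ p∤a , p∤a ]′ ∘ euclidsLemmaᶻ (+ a) (+ a) p-prime ]′ (euclidsLemmaᶻ (+ 3) (+ a * + a) p-prime p∣3a²)
        where
          a = x ℕ./ p
          b = x ℕ.% p
          b≡a : b ≡ a
          b≡a = trans (sym (τ/ x)) (cong (ℕ._/ p) τx≡x)
          c≡b : c a b ≡ b
          c≡b = trans (sym (τ% x)) (cong (ℕ._% p) τx≡x)
          a≡third : + a ≡ third (+ a) (+ a) [mod p ]
          a≡third = subst (λ v → + v ≡ third (+ a) (+ v) [mod p ]) b≡a
                          (subst (λ w → + w ≡ third (+ a) (+ b) [mod p ]) c≡b (c≡third a b))
          diagonal : ∀ m a → a * a + a * (m - a - a) + (m - a - a) * a + + 2 * a * (a - (m - a - a)) ≡ + 3 * (a * a)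
          diagonal = solve-∀
          m-from-diagonal : ∀ m a → m ≡ + 3 * a - (a - (m - a - a))
          m-from-diagonal = solve-∀
          p∣3a² : p ∣ᶻ + 3 * (+ a * + a)
          p∣3a² = subst (p ∣ᶻ_) (diagonal (+ m) (+ a))
                        (∣m∣n⇒∣m+n (subst (λ v → p ∣ᶻ e₂ (+ a) (+ v)) b≡a Sx) (∣n⇒∣m*n (+ 2 * + a) (∣-difference a≡third)))
          p∤3 : ¬ p ∣ᶻ + 3
          p∤3 p∣3 = p≢3 (prime∣prime⇒≡ p-prime prime[3] (∣⇒∣ᵤ p∣3))
          p∤a : ¬ p ∣ᶻ + a
          p∤a p∣a = p∤ᶻm (subst (p ∣ᶻ_) (sym (m-from-diagonal (+ m) (+ a)))
                                (∣m∣n⇒∣m-n (∣n⇒∣m*n (+ 3) p∣a) (∣-difference a≡third)))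

    3∣count-e₂ : 3 ∣ ∑² (λ a b → 𝟙 (e₂? a b))
    3∣count-e₂ = subst (3 ∣_) (∑²-encode (λ a b → 𝟙 (e₂? a b)))
      (3∣∑ (p ℕ.* p) τ (λ x → e₂? (x ℕ./ p) (x ℕ.% p)) τ< τ³≡id τ-preserves no-fixed-point)

  two-roots : ∀ t₀ → t₀ ℕ.< p → p ∣ᶻ + α t₀ → r ℕ.≤ 2
  two-roots t₀ t₀<p p∣αt₀ = ℕ.≤-trans (∑-mono-≤ p root⇒t₀∨t₁) (ℕ.≤-reflexive (begin
    ∑[ t < p ] (𝟙 (t ℕ.≟ t₀) ℕ.+ 𝟙 (t ℕ.≟ t₁))
      ≡⟨ ∑-distrib-+ p (λ t → 𝟙 (t ℕ.≟ t₀)) (λ t → 𝟙 (t ℕ.≟ t₁)) ⟩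
    ∑[ t < p ] 𝟙 (t ℕ.≟ t₀) ℕ.+ ∑[ t < p ] 𝟙 (t ℕ.≟ t₁)
      ≡⟨ cong₂ ℕ._+_ (one-point t₀<p) (one-point (n%ℕd<d (-1ℤ - + t₀) p)) ⟩
    2 ∎))
    where
      t₁ : ℕ
      t₁ = (-1ℤ - + t₀) %ℕ p
      one-point : ∀ {b} → b ℕ.< p → ∑[ t < p ] 𝟙 (t ℕ.≟ b) ≡ 1
      one-point {b} b<p = ∑-unique-count p b (λ t → t ℕ.≟ b) b<p refl (λ _ _ t≡b → t≡b)
      factorise : ∀ t s → (1ℤ + t + t * t) - (1ℤ + s + s * s) ≡ (t - s) * (t + s + 1ℤ)
      factorise = solve-∀
      other-root : ∀ t s → t - (-1ℤ - s) ≡ t + s + 1ℤ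
      other-root = solve-∀
      roots : ∀ t → t ℕ.< p → p ∣ᶻ + α t → t ≡ t₀ ⊎ t ≡ t₁
      roots t t<p p∣αt = [ (λ p∣t-t₀ → inj₁ (≡-mod⇒≡ t<p t₀<p (≡-mod p∣t-t₀)))
                         , (λ p∣t+t₀+1 → inj₂ (sym (%ℕ-unique p { -1ℤ - + t₀} (≡-mod-sym (≡-mod
                              (subst (p ∣ᶻ_) (sym (other-root (+ t) (+ t₀))) p∣t+t₀+1))) t<p))) ]′
                           (euclidsLemmaᶻ (+ t - + t₀) (+ t + + t₀ + 1ℤ) p-prime p∣product)
        where
          p∣product : p ∣ᶻ (+ t - + t₀) * (+ t + + t₀ + 1ℤ)
          p∣product = subst (p ∣ᶻ_) (trans (cong₂ _-_ (α-form t) (α-form t₀)) (factorise (+ t) (+ t₀))) (∣m∣n⇒∣m-n p∣αt p∣αt₀)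
      root⇒t₀∨t₁ : ∀ t → t ℕ.< p → 𝟙 (p ∣ᶻ? + α t) ℕ.≤ 𝟙 (t ℕ.≟ t₀) ℕ.+ 𝟙 (t ℕ.≟ t₁)
      root⇒t₀∨t₁ t t<p = 𝟙-mono-⊎ (roots t t<p) (p ∣ᶻ? + α t) (t ℕ.≟ t₀) (t ℕ.≟ t₁)

  r≤2 : r ℕ.≤ 2
  r≤2 = r≤2′ (r ℕ.≟ 0)
    where
      r≤2′ : Dec (r ≡ 0) → r ℕ.≤ 2
      r≤2′ (yes r≡0) = ℕ.≤-trans (ℕ.≤-reflexive r≡0) ℕ.z≤n
      r≤2′ (no r≢0)  = let t₀ , t₀<p , 𝟙≢0 = ∑≢0⇒∃ p (λ t → 𝟙 (p ∣ᶻ? + α t)) r≢0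
                       in two-roots t₀ t₀<p (𝟙≢0⇒ (p ∣ᶻ? + α t₀) 𝟙≢0)

  r≡[p+1]%3 : p ≢ 3 → r ≡ suc p ℕ.% 3
  r≡[p+1]%3 p≢3 = begin
    r                                   ≡⟨ ℕ.m<n⇒m%n≡m (ℕ.s≤s r≤2) ⟨
    r ℕ.% 3                             ≡⟨ ℕ.[m+kn]%n≡m%n r k 3 ⟨
    (r ℕ.+ k ℕ.* 3) ℕ.% 3               ≡⟨ cong (ℕ._% 3) (trans (cong (r ℕ.+_) (sym count≡k*3)) (ℕ.+-comm r _)) ⟩
    (∑² (λ a b → 𝟙 (e₂? a b)) ℕ.+ r) ℕ.% 3 ≡⟨ cong (ℕ._% 3) count-e₂+r ⟩
    suc p ℕ.% 3                         ∎
    where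
      k = quotient (3∣count-e₂ p≢3)
      count≡k*3 = m∣n⇒n≡quotient*m (3∣count-e₂ p≢3)

  -- For p = 3 both sides are evaluated; otherwise r ≡ p + 1 (mod 3) and r ≤ 2 determine r.
  h≡p+1-r : h p ≡ + p + 1ℤ - + r
  h≡p+1-r with p′ ℕ.≟ 2
  ... | yes refl = refl
  ... | no p′≢2 = h≡p+1-r′ (p′≢2 ∘ ℕ.suc-injective)
    where
      suc-%3 : ∀ {k} → p ℕ.% 3 ≡ k → suc p ℕ.% 3 ≡ suc k ℕ.% 3
      suc-%3 p%3≡k = trans (ℕ.%-distribˡ-+ 1 p 3) (cong (λ x → (1 ℕ.+ x) ℕ.% 3) p%3≡k)
      h≡p+1-r′ : p ≢ 3 → h p ≡ + p + 1ℤ - + r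
      h≡p+1-r′ p≢3 with p ℕ.% 3 in p%3
      ... | 0 = ⊥-elim (p≢3 (sym (prime∣prime⇒≡ prime[3] p-prime (m%n≡0⇒n∣m p 3 p%3))))
      ... | 1 = trans (p-1 (+ p)) (cong (λ x → + p + 1ℤ - + x) (sym (trans (r≡[p+1]%3 p≢3) (suc-%3 p%3))))
        where p-1 : ∀ P → P - + 1 ≡ P + 1ℤ - + 2
              p-1 = solve-∀
      ... | 2 = trans (p+1 (+ p)) (cong (λ x → + p + 1ℤ - + x) (sym (trans (r≡[p+1]%3 p≢3) (suc-%3 p%3))))
        where p+1 : ∀ P → P + + 1 ≡ P + 1ℤ - + 0
              p+1 = solve-∀
      ... | suc (suc (suc _)) = ⊥-elim (ℕ.<⇒≱ (ℕ.m%n<n p 3) (subst (3 ℕ.≤_) (sym p%3) (ℕ.s≤s (ℕ.s≤s (ℕ.s≤s ℕ.z≤n)))))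

  G-prime : + G p ≡ + p * + p - + 3 * + p + (+ 6 - h p)
  G-prime = begin
    + G p
      ≡⟨ eliminate (+ G p) (+ #e₃) (+ #e₂) (+ r) ⟩
    (+ G p + + #e₃ + + #e₂) - (+ #e₃ + + 3) - (+ #e₂ + + r) + + 3 + + r
      ≡⟨ cong₂ (λ x y → x - y - (+ #e₂ + + r) + + 3 + + r) G-i-e count-e₃ᶻ ⟩
    (+ p * + p + + 3) - (+ p + + p + + p) - (+ #e₂ + + r) + + 3 + + r
      ≡⟨ cong (λ x → (+ p * + p + + 3) - (+ p + + p + + p) - x + + 3 + + r) count-e₂+rᶻ ⟩
    (+ p * + p + + 3) - (+ p + + p + + p) - (1ℤ + + p) + + 3 + + r
      ≡⟨ simplify (+ p) (+ r) ⟩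
    + p * + p - + 3 * + p + (+ 6 - (+ p + 1ℤ - + r))
      ≡⟨ cong (λ x → + p * + p - + 3 * + p + (+ 6 - x)) h≡p+1-r ⟨
    + p * + p - + 3 * + p + (+ 6 - h p) ∎
    where
      #e₃ #e₂ : ℕ
      #e₃ = ∑² (λ a b → 𝟙 (e₃? a b))
      #e₂ = ∑² (λ a b → 𝟙 (e₂? a b))
      +-cast₃ : ∀ x y z → + (x ℕ.+ y ℕ.+ z) ≡ + x + + y + + z
      +-cast₃ x y z = trans (ℤ.pos-+ (x ℕ.+ y) z) (cong (_+ + z) (ℤ.pos-+ x y))
      G-i-e : + G p + + #e₃ + + #e₂ ≡ + p * + p + + 3
      G-i-e = trans (sym (+-cast₃ (G p) #e₃ #e₂))
                    (trans (cong +_ G-inclusion-exclusion) (trans (ℤ.pos-+ (p ℕ.* p) 3) (cong (_+ + 3) (ℤ.pos-* p p))))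
      count-e₃ᶻ : + #e₃ + + 3 ≡ + p + + p + + p
      count-e₃ᶻ = trans (sym (ℤ.pos-+ #e₃ 3)) (trans (cong +_ count-e₃) (+-cast₃ p p p))
      count-e₂+rᶻ : + #e₂ + + r ≡ 1ℤ + + p
      count-e₂+rᶻ = trans (sym (ℤ.pos-+ #e₂ r)) (trans (cong +_ count-e₂+r) (ℤ.pos-+ 1 p))
      eliminate : ∀ g s₃ s₂ r → g ≡ (g + s₃ + s₂) - (s₃ + + 3) - (s₂ + r) + + 3 + r
      eliminate = solve-∀
      simplify : ∀ P r → (P * P + + 3) - (P + P + P) - (1ℤ + P) + + 3 + r ≡ P * P - + 3 * P + (+ 6 - (P + 1ℤ - r))
      simplify = solve-∀

module Rationals where
  open import Data.Integer as ℤ using (ℤ; +_)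
  import Data.Integer.Properties as ℤ
  open import Data.Integer.Tactic.RingSolver using (solve-∀)
  open import Data.Nat as ℕ using (ℕ; suc)
  import Data.Nat.Properties as ℕ
  open import Data.Rational using (ℚ; _/_; 1ℚ; _+_; _*_; _-_; -_; toℚᵘ)
  open import Data.Rational.Properties using (toℚᵘ-injective; toℚᵘ-fromℚᵘ; toℚᵘ-homo-+; toℚᵘ-homo-*; toℚᵘ-homo‿-; *-identityʳ)
  open import Data.Rational.Solver using (module +-*-Solver)
  open import Data.Rational.Unnormalised as ℚᵘ using (mkℚᵘ; *≡*; _≃_)
  import Data.Rational.Unnormalised.Properties as ℚᵘ
  open import Relation.Binary.PropositionalEquality
  open ≡-Reasoning

  ι : ℤ → ℚ
  ι i = i / 1

  private
    toℚᵘ-/ : ∀ i k → toℚᵘ (i / suc k) ≃ mkℚᵘ i k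
    toℚᵘ-/ i k = toℚᵘ-fromℚᵘ (mkℚᵘ i k)

    by-cross-multiplication : ∀ {x y : ℚ} {i j : ℤ} {k l : ℕ} → toℚᵘ x ≃ mkℚᵘ i k → toℚᵘ y ≃ mkℚᵘ j l →
                              i ℤ.* + suc l ≡ j ℤ.* + suc k → x ≡ y
    by-cross-multiplication x≃ y≃ cross = toℚᵘ-injective (ℚᵘ.≃-trans x≃ (ℚᵘ.≃-trans (*≡* cross) (ℚᵘ.≃-sym y≃)))

  ι-+ : ∀ i j → ι (i ℤ.+ j) ≡ ι i + ι j
  ι-+ i j = by-cross-multiplication (toℚᵘ-/ (i ℤ.+ j) 0)
    (ℚᵘ.≃-trans (toℚᵘ-homo-+ (ι i) (ι j)) (ℚᵘ.+-cong (toℚᵘ-/ i 0) (toℚᵘ-/ j 0))) (normalise i j)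
    where normalise : ∀ i j → (i ℤ.+ j) ℤ.* + 1 ≡ (i ℤ.* + 1 ℤ.+ j ℤ.* + 1) ℤ.* + 1
          normalise = solve-∀

  ι-* : ∀ i j → ι (i ℤ.* j) ≡ ι i * ι j
  ι-* i j = by-cross-multiplication (toℚᵘ-/ (i ℤ.* j) 0)
    (ℚᵘ.≃-trans (toℚᵘ-homo-* (ι i) (ι j)) (ℚᵘ.*-cong (toℚᵘ-/ i 0) (toℚᵘ-/ j 0))) refl

  ι-neg : ∀ i → ι (ℤ.- i) ≡ - ι i
  ι-neg i = by-cross-multiplication (toℚᵘ-/ (ℤ.- i) 0)
    (ℚᵘ.≃-trans (toℚᵘ-homo‿- (ι i)) (ℚᵘ.-‿cong (toℚᵘ-/ i 0))) refl

  ι-- : ∀ i j → ι (i ℤ.- j) ≡ ι i - ι j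
  ι-- i j = trans (ι-+ i (ℤ.- j)) (cong (_+_ (ι i)) (ι-neg j))

  ι-+* : ∀ a b → ι (+ (a ℕ.* b)) ≡ ι (+ a) * ι (+ b)
  ι-+* a b = trans (cong ι (ℤ.pos-* a b)) (ι-* (+ a) (+ b))

  /-as-* : ∀ i k → i / suc k ≡ ι i * (+ 1 / suc k)
  /-as-* i k = by-cross-multiplication (toℚᵘ-/ i k)
    (ℚᵘ.≃-trans (toℚᵘ-homo-* (ι i) (+ 1 / suc k)) (ℚᵘ.*-cong (toℚᵘ-/ i 0) (toℚᵘ-/ (+ 1) k)))
    (trans (cong (λ d → i ℤ.* + suc d) (ℕ.+-identityʳ k)) (normalise i (+ suc k)))
    where normalise : ∀ i d → i ℤ.* d ≡ (i ℤ.* + 1) ℤ.* d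
          normalise = solve-∀

  1/-* : ∀ a b → + 1 / (suc a ℕ.* suc b) ≡ (+ 1 / suc a) * (+ 1 / suc b)
  1/-* a b = by-cross-multiplication (toℚᵘ-/ (+ 1) (b ℕ.+ a ℕ.* suc b))
    (ℚᵘ.≃-trans (toℚᵘ-homo-* (+ 1 / suc a) (+ 1 / suc b)) (ℚᵘ.*-cong (toℚᵘ-/ (+ 1) a) (toℚᵘ-/ (+ 1) b)))
    (normalise (+ suc (b ℕ.+ a ℕ.* suc b)))
    where normalise : ∀ d → + 1 ℤ.* d ≡ (+ 1 ℤ.* + 1) ℤ.* d
          normalise = solve-∀

  ι*1/ : ∀ k → ι (+ suc k) * (+ 1 / suc k) ≡ 1ℚ
  ι*1/ k = toℚᵘ-injective (ℚᵘ.≃-trans (toℚᵘ-homo-* (ι (+ suc k)) (+ 1 / suc k))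
    (ℚᵘ.≃-trans (ℚᵘ.*-cong (toℚᵘ-/ (+ suc k) 0) (toℚᵘ-/ (+ 1) k))
                (*≡* (trans (normalise (+ suc k)) (cong (λ d → + 1 ℤ.* + suc d) (sym (ℕ.+-identityʳ k)))))))
    where normalise : ∀ d → (d ℤ.* + 1) ℤ.* + 1 ≡ + 1 ℤ.* d
          normalise = solve-∀

  scale-by-square : ∀ P I t c → P * I ≡ 1ℚ → P * P - t * P + c ≡ (P * P) * (1ℚ - t * I + c * (I * I))
  scale-by-square P I t c P*I≡1 = sym (begin
    (P * P) * (1ℚ - t * I + c * (I * I))
      ≡⟨ expand P I t c ⟩
    (P * P) * 1ℚ - t * P * (P * I) + c * ((P * I) * (P * I))
      ≡⟨ cong (λ u → (P * P) * 1ℚ - t * P * u + c * (u * u)) P*I≡1 ⟩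
    (P * P) * 1ℚ - t * P * 1ℚ + c * (1ℚ * 1ℚ)
      ≡⟨ cong₂ (λ u v → u - v + c * (1ℚ * 1ℚ)) (*-identityʳ (P * P)) (*-identityʳ (t * P)) ⟩
    P * P - t * P + c * (1ℚ * 1ℚ)
      ≡⟨ cong (λ u → P * P - t * P + u) (*-identityʳ c) ⟩
    P * P - t * P + c ∎)
    where
      open +-*-Solver
      expand : ∀ P I t c → (P * P) * (1ℚ - t * I + c * (I * I)) ≡ (P * P) * 1ℚ - t * P * (P * I) + c * ((P * I) * (P * I))
      expand = solve 4 (λ P I t c → (P :* P) :* (con 1ℚ :- t :* I :+ c :* (I :* I))
                                 := (P :* P) :* con 1ℚ :- t :* P :* (P :* I) :+ c :* ((P :* I) :* (P :* I))) refl

module PrimeProducts where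
  open import Data.Empty using (⊥-elim)
  open import Data.Nat hiding (_*_)
  open import Data.Nat.Divisibility using (_∣?_; ∣⇒≤)
  open import Data.Nat.Primality using (prime?; prime⇒nonZero)
  import Data.Nat.Properties as ℕ
  open import Data.Rational using (_*_)
  open import Data.Rational.Properties using (*-assoc; *-comm)
  open import Data.Sum using (inj₁; inj₂)
  open import Function using (_⇔_; Equivalence)
  open import Relation.Binary.PropositionalEquality
  open Defs using (prodUpTo; primeProd; factor)
  open PrimeDivisors using (prime>1)
  open Equivalence

  prodUpTo-cong : ∀ n n′ k → (∀ q → Prime q → q ≤ k → q ∣ n ⇔ q ∣ n′) → prodUpTo n k ≡ prodUpTo n′ k
  prodUpTo-cong n n′ zero    same = refl
  prodUpTo-cong n n′ (suc k) same with prime? (suc k) | suc k ∣? n | suc k ∣? n′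
  ... | yes k-prime | yes k∣n | yes _    = cong (_* factor (suc k)) (prodUpTo-cong n n′ k (λ q pr q≤k → same q pr (ℕ.m≤n⇒m≤1+n q≤k)))
  ... | yes k-prime | yes k∣n | no k∤n′  = ⊥-elim (k∤n′ (to (same (suc k) k-prime ℕ.≤-refl) k∣n))
  ... | yes k-prime | no k∤n  | yes k∣n′ = ⊥-elim (k∤n (from (same (suc k) k-prime ℕ.≤-refl) k∣n′))
  ... | yes _       | no _    | no _     = prodUpTo-cong n n′ k (λ q pr q≤k → same q pr (ℕ.m≤n⇒m≤1+n q≤k))
  ... | no _        | _       | _        = prodUpTo-cong n n′ k (λ q pr q≤k → same q pr (ℕ.m≤n⇒m≤1+n q≤k))

  prodUpTo-beyond : ∀ n k .{{_ : NonZero n}} → n ≤ k → prodUpTo n k ≡ primeProd n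
  prodUpTo-beyond n k n≤k with ℕ.m≤n⇒m<n∨m≡n n≤k
  ... | inj₂ refl = refl
  prodUpTo-beyond n (suc k) _ | inj₁ (s≤s n≤k) with prime? (suc k) | suc k ∣? n
  ... | yes _ | yes k∣n = ⊥-elim (ℕ.<⇒≱ (s≤s n≤k) (∣⇒≤ k∣n))
  ... | yes _ | no _    = prodUpTo-beyond n k n≤k
  ... | no _  | _       = prodUpTo-beyond n k n≤k

  module _ {n n′ q : ℕ} (q-prime : Prime q) (q∣n : q ∣ n) (q∤n′ : ¬ q ∣ n′)
           (others : ∀ r → Prime r → r ≢ q → r ∣ n ⇔ r ∣ n′) where

    private instance
      q≢0 : NonZero q
      q≢0 = prime⇒nonZero q-prime

    prodUpTo-insert : ∀ k → q ≤ k → prodUpTo n k ≡ prodUpTo n′ k * factor q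
    prodUpTo-insert zero    q≤0 = ⊥-elim (ℕ.<⇒≱ (prime>1 q-prime) (ℕ.≤-trans q≤0 z≤n))
    prodUpTo-insert (suc k) q≤1+k with ℕ.m≤n⇒m<n∨m≡n q≤1+k
    ... | inj₂ refl with prime? q | q ∣? n | q ∣? n′
    ...   | yes _ | yes _ | no _    = cong (_* factor q) (prodUpTo-cong n n′ k (λ r pr r≤k → others r pr (λ { refl → ℕ.<-irrefl refl r≤k })))
    ...   | no ¬q-prime | _ | _     = ⊥-elim (¬q-prime q-prime)
    ...   | _ | no q∤n | _          = ⊥-elim (q∤n q∣n)
    ...   | _ | _ | yes q∣n′        = ⊥-elim (q∤n′ q∣n′)
    prodUpTo-insert (suc k) _ | inj₁ (s≤s q≤k) with prime? (suc k) | suc k ∣? n | suc k ∣? n′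
    ... | yes k-prime | yes k∣n | yes _ = trans (cong (_* factor (suc k)) (prodUpTo-insert k q≤k))
                                                (swap (prodUpTo n′ k) (factor q) (factor (suc k)))
      where swap : ∀ a b c → (a * b) * c ≡ (a * c) * b
            swap a b c = trans (*-assoc a b c) (trans (cong (a *_) (*-comm b c)) (sym (*-assoc a c b)))
    ... | yes k-prime | yes k∣n | no k∤n′  = ⊥-elim (k∤n′ (to (others (suc k) k-prime (ℕ.>⇒≢ (s≤s q≤k))) k∣n))
    ... | yes k-prime | no k∤n  | yes k∣n′ = ⊥-elim (k∤n (from (others (suc k) k-prime (ℕ.>⇒≢ (s≤s q≤k))) k∣n′))
    ... | yes _       | no _    | no _     = prodUpTo-insert k q≤k
    ... | no _        | _       | _        = prodUpTo-insert k q≤k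

module Formula (m : ℕ) where
  open import Data.Empty using (⊥-elim)
  open import Data.Integer as ℤ using (+_)
  open import Data.Nat as ℕ using (NonZero; _*_; _^_; _<_; _≟_)
  open import Data.Nat.Coprimality using (Coprime)
  open import Data.Nat.Divisibility using (_∣?_; ∣-trans; n∣m*n; m∣m*n; quotient; m∣n⇒n≡m*quotient; quotient-<; quotient≢0)
  open import Data.Nat.Induction using (<-rec)
  open import Data.Nat.Primality using (euclidsLemma; prime⇒nonZero; prime⇒nonTrivial)
  import Data.Nat.Properties as ℕ
  open import Data.Nat.Solver using (module +-*-Solver)
  import Data.Rational.Solver
  open import Data.Product using (_,_)
  open import Data.Rational using (ℚ; _/_; 1ℚ) renaming (_*_ to _*ℚ_)
  open import Data.Rational.Properties using (*-assoc)
  open import Data.Sum using ([_,_]′)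
  open import Function using (_∘_; _⇔_; mk⇔; id)
  open import Relation.Binary.PropositionalEquality
  open Defs using (h; factor; primeProd)
  open PrimeDivisors using (prime≢1; prime∣prime⇒≡; prime-factor; prime∤⇒coprime)
  open PairCount m using (G; G-1; G-*; G-lift)
  open Rationals
  open PrimeProducts
  open ≡-Reasoning

  Formula : ℕ → Set
  Formula n = ι (+ G n) ≡ ι (+ (n ^ 2)) *ℚ primeProd n

  private
    square-* : ∀ a b → (a * b) ^ 2 ≡ a ^ 2 * b ^ 2
    square-* = solve 2 (λ a b → (a :* b) :^ 2 := a :^ 2 :* b :^ 2) refl
      where open +-*-Solver

    ι-square : ∀ a → ι (+ (a ^ 2)) ≡ ι (+ a) *ℚ ι (+ a)
    ι-square a = trans (cong (ι ∘ +_ ∘ (a *_)) (ℕ.*-identityʳ a)) (ι-+* a a)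

  local-factor : ∀ q → Prime q → ¬ q ∣ m → .{{_ : NonZero q}} → ι (+ G q) ≡ ι (+ (q ^ 2)) *ℚ factor q
  local-factor (suc q′) q-prime q∤m = begin
    ι (+ G q)
      ≡⟨ cong ι (LocalCount.G-prime m q-prime q∤m) ⟩
    ι (+ q ℤ.* + q ℤ.- + 3 ℤ.* + q ℤ.+ c)
      ≡⟨ trans (ι-+ (+ q ℤ.* + q ℤ.- + 3 ℤ.* + q) c)
         (cong (_+ ι c) (trans (ι-- (+ q ℤ.* + q) (+ 3 ℤ.* + q)) (cong₂ _-_ (ι-* (+ q) (+ q)) (ι-* (+ 3) (+ q))))) ⟩
    Q *ℚ Q - ι (+ 3) *ℚ Q + ι c
      ≡⟨ scale-by-square Q I (ι (+ 3)) (ι c) (ι*1/ q′) ⟩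
    (Q *ℚ Q) *ℚ (1ℚ - ι (+ 3) *ℚ I + ι c *ℚ (I *ℚ I))
      ≡⟨ cong₂ _*ℚ_ (sym (ι-square q)) (sym factor-form) ⟩
    ι (+ (q ^ 2)) *ℚ factor q ∎
    where
      open Data.Rational using (_+_; _-_)
      q = suc q′
      Q I : ℚ
      Q = ι (+ q)
      I = + 1 / q
      c = + 6 ℤ.- h q
      factor-form : factor q ≡ 1ℚ - ι (+ 3) *ℚ I + ι c *ℚ (I *ℚ I)
      factor-form = cong₂ (λ u v → 1ℚ - u + v) (/-as-* (+ 3) q′)
        (trans (/-as-* c (q′ * 1 ℕ.+ q′ * suc (q′ * 1)))
               (cong (ι c *ℚ_) (trans (1/-* q′ (q′ * 1)) (cong (λ k → I *ℚ (+ 1 / suc k)) (ℕ.*-identityʳ q′)))))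

  module _ {q n′ : ℕ} (q-prime : Prime q) .{{_ : NonZero n′}} where

    private instance
      q≢0 : NonZero q
      q≢0 = prime⇒nonZero q-prime

    formula-repeated-prime : q ∣ n′ → Formula n′ → Formula (q * n′)
    formula-repeated-prime q∣n′ IH = begin
      ι (+ G (q * n′))                                         ≡⟨ cong (ι ∘ +_) (G-lift q n′ radical) ⟩
      ι (+ (q * q * G n′))                                     ≡⟨ ι-+* (q * q) (G n′) ⟩
      ι (+ (q * q)) *ℚ ι (+ G n′)                              ≡⟨ cong (ι (+ (q * q)) *ℚ_) IH ⟩
      ι (+ (q * q)) *ℚ (ι (+ (n′ ^ 2)) *ℚ primeProd n′)        ≡⟨ *-assoc (ι (+ (q * q))) (ι (+ (n′ ^ 2))) (primeProd n′) ⟨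
      ι (+ (q * q)) *ℚ ι (+ (n′ ^ 2)) *ℚ primeProd n′          ≡⟨ cong₂ _*ℚ_ (sym square) (sym same-primes) ⟩
      ι (+ ((q * n′) ^ 2)) *ℚ primeProd (q * n′)               ∎
      where
        radical : ∀ r → Prime r → r ∣ q * n′ → r ∣ n′
        radical r r-prime r∣qn′ = [ (λ r∣q → subst (_∣ n′) (sym (prime∣prime⇒≡ r-prime q-prime r∣q)) q∣n′) , id ]′
                                    (euclidsLemma q n′ r-prime r∣qn′)
        square : ι (+ ((q * n′) ^ 2)) ≡ ι (+ (q * q)) *ℚ ι (+ (n′ ^ 2))
        square = trans (cong (ι ∘ +_) (trans (square-* q n′) (cong (λ x → q * x * n′ ^ 2) (ℕ.*-identityʳ q))))
                       (ι-+* (q * q) (n′ ^ 2))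
        same-primes : primeProd (q * n′) ≡ primeProd n′
        same-primes = trans (prodUpTo-cong (q * n′) n′ (q * n′)
                                           (λ r r-prime _ → mk⇔ (radical r r-prime) (λ r∣n′ → ∣-trans r∣n′ (n∣m*n q))))
                            (prodUpTo-beyond n′ (q * n′) (ℕ.m≤n*m n′ q))

    formula-new-prime : ¬ q ∣ m → ¬ q ∣ n′ → Formula n′ → Formula (q * n′)
    formula-new-prime q∤m q∤n′ IH = begin
      ι (+ G (q * n′))
        ≡⟨ cong (ι ∘ +_) (G-* q n′ (prime∤⇒coprime q-prime q∤n′)) ⟩
      ι (+ (G q * G n′))
        ≡⟨ ι-+* (G q) (G n′) ⟩
      ι (+ G q) *ℚ ι (+ G n′)
        ≡⟨ cong₂ _*ℚ_ (local-factor q q-prime q∤m) IH ⟩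
      (ι (+ (q ^ 2)) *ℚ factor q) *ℚ (ι (+ (n′ ^ 2)) *ℚ primeProd n′)
        ≡⟨ rearrange (ι (+ (q ^ 2))) (factor q) (ι (+ (n′ ^ 2))) (primeProd n′) ⟩
      (ι (+ (q ^ 2)) *ℚ ι (+ (n′ ^ 2))) *ℚ (primeProd n′ *ℚ factor q)
        ≡⟨ cong₂ _*ℚ_ (sym square) (sym extra-prime) ⟩
      ι (+ ((q * n′) ^ 2)) *ℚ primeProd (q * n′) ∎
      where
        rearrange : ∀ a b c d → (a *ℚ b) *ℚ (c *ℚ d) ≡ (a *ℚ c) *ℚ (d *ℚ b)
        rearrange = solve 4 (λ a b c d → (a :* b) :* (c :* d) := (a :* c) :* (d :* b)) refl
          where open Data.Rational.Solver.+-*-Solver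
        square : ι (+ ((q * n′) ^ 2)) ≡ ι (+ (q ^ 2)) *ℚ ι (+ (n′ ^ 2))
        square = trans (cong (ι ∘ +_) (square-* q n′)) (ι-+* (q ^ 2) (n′ ^ 2))
        others : ∀ r → Prime r → r ≢ q → (r ∣ q * n′) ⇔ (r ∣ n′)
        others r r-prime r≢q = mk⇔
          (λ r∣qn′ → [ ⊥-elim ∘ r≢q ∘ prime∣prime⇒≡ r-prime q-prime , id ]′ (euclidsLemma q n′ r-prime r∣qn′))
          (λ r∣n′ → ∣-trans r∣n′ (n∣m*n q))
        extra-prime : primeProd (q * n′) ≡ primeProd n′ *ℚ factor q
        extra-prime = trans (prodUpTo-insert q-prime (m∣m*n n′) q∤n′ others (q * n′) (ℕ.m≤m*n q n′))
                            (cong (_*ℚ factor q) (prodUpTo-beyond n′ (q * n′) (ℕ.m≤n*m n′ q)))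

  formula : ∀ n → .{{_ : NonZero n}} → Coprime m n → Formula n
  formula = <-rec (λ n → .{{_ : NonZero n}} → Coprime m n → Formula n) step
    where
      step : ∀ n → (∀ {k} → k < n → .{{_ : NonZero k}} → Coprime m k → Formula k) → .{{_ : NonZero n}} → Coprime m n → Formula n
      step n IH m⊥n = by-cases (n ≟ 1)
        where
          split : ∀ {q} → Prime q → q ∣ n → Formula n
          split {q} q-prime q∣n = subst Formula (sym n≡qn′) (extend (q ∣? n′))
            where
              n′ = quotient q∣n
              n≡qn′ : n ≡ q * n′
              n≡qn′ = m∣n⇒n≡m*quotient q∣n
              instance
                n′≢0 : NonZero n′
                n′≢0 = quotient≢0 q∣n
              IH′ : Formula n′
              IH′ = IH (quotient-< q∣n {{prime⇒nonTrivial q-prime}})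
                       (λ (i∣m , i∣n′) → m⊥n (i∣m , subst (_ ∣_) (sym n≡qn′) (∣-trans i∣n′ (n∣m*n q))))
              q∤m : ¬ q ∣ m
              q∤m q∣m = prime≢1 q-prime (m⊥n (q∣m , q∣n))
              extend : Dec (q ∣ n′) → Formula (q * n′)
              extend (yes q∣n′) = formula-repeated-prime q-prime q∣n′ IH′
              extend (no q∤n′)  = formula-new-prime q-prime q∤m q∤n′ IH′
          by-cases : Dec (n ≡ 1) → Formula n
          by-cases (yes n≡1) = subst Formula (sym n≡1) (cong (ι ∘ +_) G-1)
          by-cases (no n≢1)  = let q , q-prime , q∣n = prime-factor n n≢1 in split q-prime q∣n

open import Defs
open import Data.Nat using (_≤_; _^_; >-nonZero)
open import Data.Nat.GCD using (gcd)
open import Data.Nat.Coprimality using (gcd≡1⇒coprime)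
open import Data.Integer using (+_)
open import Data.Rational using (ℚ; _/_; _*_)
open import Relation.Binary.PropositionalEquality using (_≡_; trans; cong)

mainTheorem13 : (m n : ℕ) → 1 ≤ m → 1 ≤ n → gcd m n ≡ 1 →
    (+ g₃ m n) / 1 ≡ ((+ (n ^ 2)) / 1) * primeProd n
mainTheorem13 m n _ 1≤n gcd≡1 =
  trans (cong (λ g → + g / 1) (PairCount.g₃≡G m n)) (Formula.formula m n (gcd≡1⇒coprime gcd≡1))
  where instance _ = >-nonZero 1≤n
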